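{- Let $m$ and $s$ be positive integers and $a,d_1,d_2,d_3\in\mathbb{Z}/m\mathbb{Z}$. Let $D$ be the family of the six common differences $d_1,d_2,d_3,d_2-d_1,d_3-d_2,d_1-d_3$ of the arithmetic tetrahedron $\triangle=\mathrm{AS}(a,(d_1,d_2,d_3),s)$. Suppose $\triangle$ is balanced in $\mathbb{Z}/m\mathbb{Z}$. (i) If $m$ is odd, then all elements of $D$ are invertible. (ii) If $m$ is even, then all elements of $D$ are invertible except two of them, say $\delta_1$ and $\delta_2$, which are non adjacent and satisfy $\gcd(\delta_1,m)=\gcd(\delta_2,m)=2$.
   Context: $\mathrm{AS}(a,(d_1,d_2,d_3),s)$ is the multiset $\{a+i_1d_1+i_2d_2+i_3d_3: i\in\mathbb{N}^3,\ i_1+i_2+i_3\le s-1\}$ of elements of $\mathbb{Z}/m\mathbb{Z}$. A multiset is balanced if every element of $\mathbb{Z}/m\mathbb{Z}$ occurs in it with the same multiplicity. Among the six common differences, the pairs of non adjacent ones are exactly $(d_1,d_3-d_2)$, $(d_2,d_1-d_3)$ and $(d_3,d_2-d_1)$; all other pairs are adjacent. For $x\in\mathbb{Z}/m\mathbb{Z}$, $\gcd(x,m)$ denotes the gcd of $m$ and any representative of $x$. -}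

module Defs where

open import Data.Nat as ℕ using (ℕ; NonZero; _<_; _<?_)
open import Data.Nat.GCD using (gcd)
open import Data.Integer as ℤ using (ℤ; +_; ∣_∣)
open import Data.Integer.DivMod using (_%ℕ_)
open import Data.List using (List; []; _∷_; length; filter; concatMap; map; upTo)
open import Data.Product using (_×_; _,_; Σ; ∃)
open import Data.Fin using (Fin; toℕ)
open import Relation.Binary.PropositionalEquality using (_≡_)

-- Elements of ℤ/mℤ are represented by integers; x and y denote the same
-- class iff they have the same residue (x %ℕ m) ∈ {0,…,m-1}.

triples : ℕ → List (ℕ × ℕ × ℕ)
triples s = filter (λ { (i₁ , i₂ , i₃) → i₁ ℕ.+ i₂ ℕ.+ i₃ <? s })
  (concatMap (λ i₁ → concatMap (λ i₂ → map (λ i₃ → (i₁ , i₂ , i₃)) (upTo s)) (upTo s)) (upTo s))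

term : ℤ → ℤ → ℤ → ℤ → ℕ × ℕ × ℕ → ℤ
term a d₁ d₂ d₃ (i₁ , i₂ , i₃) =
  a ℤ.+ (+ i₁) ℤ.* d₁ ℤ.+ (+ i₂) ℤ.* d₂ ℤ.+ (+ i₃) ℤ.* d₃

multiplicity : (m : ℕ) .{{_ : NonZero m}} → ℤ → ℤ → ℤ → ℤ → ℕ → Fin m → ℕ
multiplicity m a d₁ d₂ d₃ s x =
  length (filter (λ i → term a d₁ d₂ d₃ i %ℕ m ℕ.≟ toℕ x) (triples s))

Balanced : (m : ℕ) .{{_ : NonZero m}} → ℤ → ℤ → ℤ → ℤ → ℕ → Set
Balanced m a d₁ d₂ d₃ s =
  ∀ (x y : Fin m) → multiplicity m a d₁ d₂ d₃ s x ≡ multiplicity m a d₁ d₂ d₃ s y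

Invertible : (m : ℕ) .{{_ : NonZero m}} → ℤ → Set
Invertible m x = ∃ λ (y : ℤ) → (x ℤ.* y) %ℕ m ≡ (+ 1) %ℕ m

gcdℤ : ℤ → ℕ → ℕ
gcdℤ x m = gcd ∣ x ∣ m

data Diff : Set where
  δ₁ δ₂ δ₃ δ₂₁ δ₃₂ δ₁₃ : Diff

value : ℤ → ℤ → ℤ → Diff → ℤ
value d₁ d₂ d₃ δ₁  = d₁
value d₁ d₂ d₃ δ₂  = d₂
value d₁ d₂ d₃ δ₃  = d₃
value d₁ d₂ d₃ δ₂₁ = d₂ ℤ.- d₁
value d₁ d₂ d₃ δ₃₂ = d₃ ℤ.- d₂
value d₁ d₂ d₃ δ₁₃ = d₁ ℤ.- d₃

data NonAdjacent : Diff → Diff → Set where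
  na₁ : NonAdjacent δ₁ δ₃₂
  na₂ : NonAdjacent δ₂ δ₁₃
  na₃ : NonAdjacent δ₃ δ₂₁
  na₁' : NonAdjacent δ₃₂ δ₁
  na₂' : NonAdjacent δ₁₃ δ₂
  na₃' : NonAdjacent δ₂₁ δ₃

-- AS(a,(d₁,d₂,d₃),s) is a translate of the (s-1)-fold dilate of the tetrahedron with vertices
-- 0, d₁, d₂, d₃, whose edges are the six common differences, and its balance modulo m passes
-- to every divisor q of m.  The next dilate is, in two ways, a face opposite one of two
-- vertices plus a translate of the balanced one, so those two faces have equal residue counts.
-- Comparing them on suitable classes shows that balance modulo q fails if exactly three or all
-- four vertices are congruent, and, for q ≥ 3, if exactly two are while q cancels the edges
-- from them to the other two.  Hence no odd prime factor of m divides an edge; modulo 2 the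
-- vertices pair up, so exactly two opposite edges are even; and if 4 ∣ m neither is divisible
-- by 4.

module Submission where

open import Defs
open import Data.Nat using (ℕ; NonZero)
open import Data.Nat.Divisibility using (_∣_)
open import Data.Integer using (ℤ)
open import Data.Product using (_×_; ∃₂)
open import Relation.Binary.PropositionalEquality using (_≡_; _≢_)
open import Relation.Nullary using (¬_)

open import Data.Nat as ℕ using (zero; suc; _+_; _*_; _∸_; _≤_; _<_; _<?_; z≤n; s≤s; _⊔_)
import Data.Nat.Properties as ℕP
import Data.Nat.Divisibility as ℕD
import Data.Nat.Tactic.RingSolver as ℕSolver
open import Data.Nat.GCD using (gcd; gcd[m,n]∣m; gcd[m,n]∣n; gcd-greatest; gcd[m,n]≢0; module Bézout)
open import Data.Nat.Coprimality using (gcd≡1⇒coprime; coprime-Bézout)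
open import Data.Nat.Primality using (Prime; euclidsLemma; prime[2]; prime⇒nonTrivial)
open import Data.Nat.Primality.Factorisation using (factorise)
open import Data.Nat.ListAction using (product)
open import Data.Integer as ℤ using (+_; ∣_∣; _%ℕ_; _/ℕ_)
import Data.Integer.Properties as ℤP
open import Data.Integer.DivMod using (a≡a%ℕn+[a/ℕn]*n; n%ℕd<d)
open import Data.Integer.Divisibility.Signed
  using (divides; ∣-trans; ∣m∣n⇒∣m+n; ∣m∣n⇒∣m-n; ∣m⇒∣-m; ∣n⇒∣m*n; ∣m⇒∣m*n; ∣ᵤ⇒∣; ∣⇒∣ᵤ)
  renaming (_∣_ to _∣ℤ_; _∣?_ to _∣ℤ?_)
open import Data.Integer.Tactic.RingSolver using (solve-∀)
open import Data.Bool using (Bool; true; false; if_then_else_; _∧_)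
open import Data.List using (List; []; _∷_; _++_; map; length; filter; concatMap; applyUpTo; upTo)
import Data.List.Properties as LP
import Data.List.Relation.Binary.Permutation.Propositional as ↭
open ↭ using (_↭_)
open import Data.List.Relation.Binary.Permutation.Propositional.Properties using (shift)
open import Data.List.Relation.Unary.All as All using (All; []; _∷_)
import Data.List.Relation.Unary.All.Properties as All
open import Data.List.Relation.Unary.Any using (here; there)
open import Data.List.Membership.Propositional using (_∈_)
open import Data.List.Membership.Propositional.Properties using (∈-map⁺; ∈-++⁺ˡ; ∈-++⁺ʳ)
open import Data.Product using (_,_; ∃; uncurry)
open import Data.Sum using (inj₁; inj₂)
open import Data.Fin using (Fin; toℕ; fromℕ<)
import Data.Fin.Properties as FinP
open import Function using (_∘_)
open import Relation.Unary using (Pred; Decidable)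
open import Level using (0ℓ)
open import Relation.Binary.PropositionalEquality
  using (refl; sym; trans; cong; cong₂; subst; subst₂; module ≡-Reasoning)
open import Relation.Nullary using (does; yes; no; contradiction)
open import Relation.Nullary.Decidable using (dec-true; dec-false; does-⇔)
open import Function.Bundles using (mk⇔)

-- Congruences

∣0 : ∀ q → + q ∣ℤ + 0
∣0 q = divides (+ 0) refl

∣x-x : ∀ q x → + q ∣ℤ x ℤ.- x
∣x-x q x = subst (+ q ∣ℤ_) (sym (ℤP.+-inverseʳ x)) (∣0 q)

q∣x-x%ℕq : ∀ q .{{_ : NonZero q}} x → + q ∣ℤ x ℤ.- + (x %ℕ q)
q∣x-x%ℕq q x = divides (x /ℕ q) (begin
  x ℤ.- + (x %ℕ q)                               ≡⟨ cong (ℤ._- + (x %ℕ q)) (a≡a%ℕn+[a/ℕn]*n x q) ⟩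
  + (x %ℕ q) ℤ.+ x /ℕ q ℤ.* + q ℤ.- + (x %ℕ q)   ≡⟨ cancel (+ (x %ℕ q)) (x /ℕ q ℤ.* + q) ⟩
  x /ℕ q ℤ.* + q                                 ∎)
  where
  open ≡-Reasoning
  cancel : ∀ r y → r ℤ.+ y ℤ.- r ≡ y
  cancel = solve-∀

∣n∧n<q⇒≡0 : ∀ {q} n → q ∣ n → n < q → n ≡ 0
∣n∧n<q⇒≡0 zero    _   _   = refl
∣n∧n<q⇒≡0 (suc n) q∣n n<q = contradiction q∣n (ℕD.>⇒∤ n<q)

∣-⇒%ℕ≡ : ∀ q .{{_ : NonZero q}} x y → + q ∣ℤ x ℤ.- y → x %ℕ q ≡ y %ℕ q
∣-⇒%ℕ≡ q x y q∣x-y = ℤP.+-injective (ℤP.i-j≡0⇒i≡j _ _ (ℤP.∣i∣≡0⇒i≡0 ∣rx-ry∣≡0))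
  where
  rx = x %ℕ q
  ry = y %ℕ q
  regroup : ∀ x y rx ry → (x ℤ.- y) ℤ.- (x ℤ.- rx) ℤ.+ (y ℤ.- ry) ≡ rx ℤ.- ry
  regroup = solve-∀
  q∣rx-ry : + q ∣ℤ + rx ℤ.- + ry
  q∣rx-ry = subst (+ q ∣ℤ_) (regroup x y (+ rx) (+ ry))
    (∣m∣n⇒∣m+n (∣m∣n⇒∣m-n q∣x-y (q∣x-x%ℕq q x)) (q∣x-x%ℕq q y))
  ∣rx-ry∣<q : ∣ + rx ℤ.- + ry ∣ < q
  ∣rx-ry∣<q = ℕP.≤-<-trans
    (subst (_≤ rx ⊔ ry) (cong ∣_∣ (sym (ℤP.m-n≡m⊖n rx ry))) (ℤP.∣m⊝n∣≤m⊔n rx ry))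
    (ℕP.⊔-lub (n%ℕd<d x q) (n%ℕd<d y q))
  ∣rx-ry∣≡0 : ∣ + rx ℤ.- + ry ∣ ≡ 0
  ∣rx-ry∣≡0 = ∣n∧n<q⇒≡0 _ (∣⇒∣ᵤ q∣rx-ry) ∣rx-ry∣<q

%ℕ≡⇒∣- : ∀ q .{{_ : NonZero q}} x y → x %ℕ q ≡ y %ℕ q → + q ∣ℤ x ℤ.- y
%ℕ≡⇒∣- q x y x≡y = subst (+ q ∣ℤ_) (cancel x y (+ (x %ℕ q)))
  (∣m∣n⇒∣m-n (q∣x-x%ℕq q x) (subst (λ r → + q ∣ℤ y ℤ.- + r) (sym x≡y) (q∣x-x%ℕq q y)))
  where
  cancel : ∀ x y r → (x ℤ.- r) ℤ.- (y ℤ.- r) ≡ x ℤ.- y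
  cancel = solve-∀

∤x-[x+1] : ∀ {q} → 1 < q → ∀ x → ¬ + q ∣ℤ x ℤ.- (x ℤ.+ + 1)
∤x-[x+1] 1<q x q∣ = ℕP.<⇒≱ 1<q (ℕD.∣⇒≤ (subst (_ ∣_) (cong ∣_∣ (minus-one x)) (∣⇒∣ᵤ q∣)))
  where
  minus-one : ∀ x → x ℤ.- (x ℤ.+ + 1) ≡ ℤ.- + 1
  minus-one = solve-∀

inClass : ℕ → ℤ → ℤ → Bool
inClass q c t = does (+ q ∣ℤ? t ℤ.- c)

inClass-diff : ∀ q {t c t' c'} → t ℤ.- c ≡ t' ℤ.- c' → inClass q c t ≡ inClass q c' t'
inClass-diff q = cong (λ x → does (+ q ∣ℤ? x))

inClass-shift : ∀ q c e t → inClass q c (e ℤ.+ t) ≡ inClass q (c ℤ.- e) t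
inClass-shift q c e t = inClass-diff q {e ℤ.+ t} {c} {t} {c ℤ.- e} (move c e t)
  where
  move : ∀ c e t → e ℤ.+ t ℤ.- c ≡ t ℤ.- (c ℤ.- e)
  move = solve-∀

inClass-cong : ∀ q t c t' c' → + q ∣ℤ (t ℤ.- c) ℤ.- (t' ℤ.- c') → inClass q c t ≡ inClass q c' t'
inClass-cong q t c t' c' q∣ = does-⇔ (mk⇔ forth back) (+ q ∣ℤ? t ℤ.- c) (+ q ∣ℤ? t' ℤ.- c')
  where
  sub-sub : ∀ x y → x ℤ.- (x ℤ.- y) ≡ y
  sub-sub = solve-∀
  add-sub : ∀ x y → y ℤ.+ (x ℤ.- y) ≡ x
  add-sub = solve-∀
  forth : + q ∣ℤ t ℤ.- c → + q ∣ℤ t' ℤ.- c'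
  forth a = subst (+ q ∣ℤ_) (sub-sub (t ℤ.- c) (t' ℤ.- c')) (∣m∣n⇒∣m-n a q∣)
  back : + q ∣ℤ t' ℤ.- c' → + q ∣ℤ t ℤ.- c
  back b = subst (+ q ∣ℤ_) (add-sub (t ℤ.- c) (t' ℤ.- c')) (∣m∣n⇒∣m+n b q∣)

-- Counting

𝟙 : Bool → ℕ
𝟙 b = if b then 1 else 0

count : {A : Set} → (A → Bool) → List A → ℕ
count p []       = 0
count p (x ∷ xs) = 𝟙 (p x) + count p xs

module _ {A : Set} where

  count-++ : ∀ (p : A → Bool) xs ys → count p (xs ++ ys) ≡ count p xs + count p ys
  count-++ p []       ys = refl
  count-++ p (x ∷ xs) ys = trans (cong₂ _+_ refl (count-++ p xs ys)) (sym (ℕP.+-assoc (𝟙 (p x)) _ _))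

  count-map : ∀ {B : Set} (p : B → Bool) (f : A → B) xs → count p (map f xs) ≡ count (p ∘ f) xs
  count-map p f []       = refl
  count-map p f (x ∷ xs) = cong₂ _+_ refl (count-map p f xs)

  count-cong : ∀ {p p' : A → Bool} → (∀ x → p x ≡ p' x) → ∀ xs → count p xs ≡ count p' xs
  count-cong p≗p' []       = refl
  count-cong p≗p' (x ∷ xs) = cong₂ _+_ (cong 𝟙 (p≗p' x)) (count-cong p≗p' xs)

  count-none : ∀ (p : A → Bool) {xs} → All (λ x → p x ≡ false) xs → count p xs ≡ 0
  count-none p []         = refl
  count-none p (px ∷ pxs) = cong₂ _+_ (cong 𝟙 px) (count-none p pxs)

  count-all : ∀ (p : A → Bool) {xs} → All (λ x → p x ≡ true) xs → count p xs ≡ length xs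
  count-all p []         = refl
  count-all p (px ∷ pxs) = cong₂ _+_ (cong 𝟙 px) (count-all p pxs)

  infix 4 _≋_
  _≋_ : List A → List A → Set
  xs ≋ ys = ∀ p → count p xs ≡ count p ys

count-∈ : ∀ {A : Set} (p : A → Bool) {x xs} → x ∈ xs → p x ≡ true → 0 < count p xs
count-∈ p {xs = _ ∷ xs} (here refl) px = subst (λ b → 0 < 𝟙 b + count p xs) (sym px) (s≤s z≤n)
count-∈ p {xs = y ∷ _} (there x∈) px = ℕP.≤-trans (count-∈ p x∈ px) (ℕP.m≤n+m _ (𝟙 (p y)))

-- Simplices

-- simplex k zs lists, with multiplicity, the sums c₁z₁ + ⋯ + cᵣzᵣ over all cᵢ ∈ ℕ with
-- c₁ + ⋯ + cᵣ = k.  With a slack vertex 0, AS(a,(d₁,d₂,d₃),s) is the translate by a of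
-- simplex (s ∸ 1) (d₁ ∷ d₂ ∷ d₃ ∷ 0 ∷ []), and the six common differences are its edges.
simplex : ℕ → List ℤ → List ℤ
simplex zero    zs       = + 0 ∷ []
simplex (suc k) []       = []
simplex (suc k) (z ∷ zs) = simplex (suc k) zs ++ map (ℤ._+_ z) (simplex k (z ∷ zs))

count-simplex : ∀ p k z zs → count p (simplex (suc k) (z ∷ zs)) ≡
  count p (simplex (suc k) zs) + count (p ∘ ℤ._+_ z) (simplex k (z ∷ zs))
count-simplex p k z zs = trans (count-++ p (simplex (suc k) zs) _)
  (cong (_+_ (count p (simplex (suc k) zs))) (count-map p (ℤ._+_ z) (simplex k (z ∷ zs))))

count-simplex₂ : ∀ p k u v zs → count p (simplex (suc k) (u ∷ v ∷ zs)) ≡ count p (simplex (suc k) zs) +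
  (count (p ∘ ℤ._+_ v) (simplex k (v ∷ zs)) + count (p ∘ ℤ._+_ u) (simplex k (u ∷ v ∷ zs)))
count-simplex₂ p k u v zs = trans (count-simplex p k u (v ∷ zs))
  (trans (cong₂ _+_ (count-simplex p k v zs) refl) (ℕP.+-assoc (count p (simplex (suc k) zs)) _ _))

mutual
  simplex-swap : ∀ k u v zs → simplex k (u ∷ v ∷ zs) ≋ simplex k (v ∷ u ∷ zs)
  simplex-swap zero    u v zs p = refl
  simplex-swap (suc k) u v zs p = trans (count-simplex₂ p k u v zs)
    (trans (cong (_+_ (count p (simplex (suc k) zs))) (peeled-sym p k u v zs)) (sym (count-simplex₂ p k v u zs)))

  -- both sides count the (k+1)-simplex on u ∷ v ∷ zs without its face on zs
  peeled-sym : ∀ p k u v zs →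
    count (p ∘ ℤ._+_ v) (simplex k (v ∷ zs)) + count (p ∘ ℤ._+_ u) (simplex k (u ∷ v ∷ zs)) ≡
    count (p ∘ ℤ._+_ u) (simplex k (u ∷ zs)) + count (p ∘ ℤ._+_ v) (simplex k (v ∷ u ∷ zs))
  peeled-sym p zero    u v zs = ℕP.+-comm (𝟙 (p (v ℤ.+ + 0)) + 0) (𝟙 (p (u ℤ.+ + 0)) + 0)
  peeled-sym p (suc k) u v zs = begin
    Pv + count pᵤ (simplex (suc k) (u ∷ v ∷ zs))        ≡⟨ cong₂ _+_ refl (simplex-swap (suc k) u v zs pᵤ) ⟩
    Pv + count pᵤ (simplex (suc k) (v ∷ u ∷ zs))        ≡⟨ cong₂ _+_ refl (count-simplex pᵤ k v (u ∷ zs)) ⟩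
    Pv + (Pu + count (pᵤ ∘ ℤ._+_ v) (simplex k (v ∷ u ∷ zs)))
      ≡⟨ cong (λ n → Pv + (Pu + n)) (trans (count-cong (λ t → cong p (+-comm-middle u v t)) (simplex k (v ∷ u ∷ zs)))
                                           (simplex-swap k v u zs (pᵥ ∘ ℤ._+_ u))) ⟩
    Pv + (Pu + count (pᵥ ∘ ℤ._+_ u) (simplex k (u ∷ v ∷ zs)))  ≡⟨ +-exchange Pv Pu _ ⟩
    Pu + (Pv + count (pᵥ ∘ ℤ._+_ u) (simplex k (u ∷ v ∷ zs)))  ≡⟨ cong₂ _+_ refl (count-simplex pᵥ k u (v ∷ zs)) ⟨
    Pu + count pᵥ (simplex (suc k) (u ∷ v ∷ zs))        ≡⟨ cong₂ _+_ refl (simplex-swap (suc k) u v zs pᵥ) ⟩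
    Pu + count pᵥ (simplex (suc k) (v ∷ u ∷ zs))        ∎
    where
    open ≡-Reasoning
    pᵤ pᵥ : ℤ → Bool
    pᵤ = p ∘ ℤ._+_ u
    pᵥ = p ∘ ℤ._+_ v
    Pu = count pᵤ (simplex (suc k) (u ∷ zs))
    Pv = count pᵥ (simplex (suc k) (v ∷ zs))
    +-exchange : ∀ x y z → x + (y + z) ≡ y + (x + z)
    +-exchange = ℕSolver.solve-∀
    +-comm-middle : ∀ u v t → u ℤ.+ (v ℤ.+ t) ≡ v ℤ.+ (u ℤ.+ t)
    +-comm-middle = solve-∀

simplex-prep : ∀ z {zs ws} → (∀ j → simplex j zs ≋ simplex j ws) → ∀ k → simplex k (z ∷ zs) ≋ simplex k (z ∷ ws)
simplex-prep z h zero p = refl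
simplex-prep z {zs} {ws} h (suc k) p = trans (count-simplex p k z zs)
  (trans (cong₂ _+_ (h (suc k) p) (simplex-prep z h k (p ∘ ℤ._+_ z))) (sym (count-simplex p k z ws)))

simplex-↭ : ∀ {zs ws} → zs ↭ ws → ∀ k → simplex k zs ≋ simplex k ws
simplex-↭ ↭.refl             k p = refl
simplex-↭ (↭.prep z π)       k   = simplex-prep z (simplex-↭ π) k
simplex-↭ (↭.swap u v π)     k p = trans (simplex-swap k u v _ p) (simplex-prep v (simplex-prep u (simplex-↭ π)) k p)
simplex-↭ (↭.trans π π')     k p = trans (simplex-↭ π k p) (simplex-↭ π' k p)

simplex-single : ∀ k y → simplex k (y ∷ []) ≡ + k ℤ.* y ∷ []
simplex-single zero    y = refl
simplex-single (suc k) y = trans (cong (map (ℤ._+_ y)) (simplex-single k y)) (cong (_∷ []) (sym (ℤP.suc-* (+ k) y)))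

simplex-vertex : ∀ k z zs → + k ℤ.* z ∈ simplex k (z ∷ zs)
simplex-vertex zero    z zs = here refl
simplex-vertex (suc k) z zs = ∈-++⁺ʳ (simplex (suc k) zs)
  (subst (_∈ map (ℤ._+_ z) (simplex k (z ∷ zs))) (sym (ℤP.suc-* (+ k) z)) (∈-map⁺ (ℤ._+_ z) (simplex-vertex k z zs)))

simplex-⊆ : ∀ k z {zs x} → x ∈ simplex k zs → x ∈ simplex k (z ∷ zs)
simplex-⊆ zero    z x∈ = x∈
simplex-⊆ (suc k) z x∈ = ∈-++⁺ˡ x∈

simplex-congruent : ∀ q {u} k zs → All (λ z → + q ∣ℤ z ℤ.- u) zs →
  All (λ t → + q ∣ℤ t ℤ.- + k ℤ.* u) (simplex k zs)
simplex-congruent q {u} zero    zs       _          = ∣x-x q (+ 0) ∷ []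
simplex-congruent q     (suc k) []       []         = []
simplex-congruent q {u} (suc k) (z ∷ zs) (z≡u ∷ zs≡u) = All.++⁺ (simplex-congruent q (suc k) zs zs≡u)
  (All.map⁺ (All.map (λ {t} t≡ku → subst (+ q ∣ℤ_) (add-diffs z t) (∣m∣n⇒∣m+n z≡u t≡ku))
                     (simplex-congruent q k (z ∷ zs) (z≡u ∷ zs≡u))))
  where
  add-diffs : ∀ z t → (z ℤ.- u) ℤ.+ (t ℤ.- + k ℤ.* u) ≡ (z ℤ.+ t) ℤ.- + suc k ℤ.* u
  add-diffs z t = trans (regroup z t u (+ k)) (cong (λ x → (z ℤ.+ t) ℤ.- x) (sym (ℤP.suc-* (+ k) u)))
    where
    regroup : ∀ z t u k → (z ℤ.- u) ℤ.+ (t ℤ.- k ℤ.* u) ≡ (z ℤ.+ t) ℤ.- (u ℤ.+ k ℤ.* u)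
    regroup = solve-∀

infix 4 _≈_[mod_]
_≈_[mod_] : List ℤ → List ℤ → ℕ → Set
xs ≈ ys [mod q ] = ∀ c → count (inClass q c) xs ≡ count (inClass q c) ys

IsBalanced : ℕ → List ℤ → Set
IsBalanced q xs = ∀ c c' → count (inClass q c) xs ≡ count (inClass q c') xs

count-translate : ∀ q c e xs → count (inClass q c ∘ ℤ._+_ e) xs ≡ count (inClass q (c ℤ.- e)) xs
count-translate q c e = count-cong (inClass-shift q c e)

count-none-congruent : ∀ q {w c xs} → All (λ t → + q ∣ℤ t ℤ.- w) xs → ¬ + q ∣ℤ w ℤ.- c →
  count (inClass q c) xs ≡ 0
count-none-congruent q {w} {c} xs≡w w≢c = count-none (inClass q c)
  (All.map (λ {t} t≡w → dec-false (+ q ∣ℤ? t ℤ.- c) (λ t≡c → w≢c (subst (+ q ∣ℤ_) (diff t c w) (∣m∣n⇒∣m-n t≡c t≡w)))) xs≡w)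
  where
  diff : ∀ t c w → (t ℤ.- c) ℤ.- (t ℤ.- w) ≡ w ℤ.- c
  diff = solve-∀

↭-isBalanced : ∀ q n {zs ws} → zs ↭ ws → IsBalanced q (simplex n zs) → IsBalanced q (simplex n ws)
↭-isBalanced q n π bal c c' =
  trans (sym (simplex-↭ π n (inClass q c))) (trans (bal c c') (simplex-↭ π n (inClass q c')))

count-simplex-exchange : ∀ p k z₀ z₁ rest →
  count p (simplex (suc k) (z₁ ∷ rest)) + count (p ∘ ℤ._+_ z₀) (simplex k (z₀ ∷ z₁ ∷ rest)) ≡
  count p (simplex (suc k) (z₀ ∷ rest)) + count (p ∘ ℤ._+_ z₁) (simplex k (z₀ ∷ z₁ ∷ rest))
count-simplex-exchange p k z₀ z₁ rest = begin
  count p (simplex (suc k) (z₁ ∷ rest)) + count (p ∘ ℤ._+_ z₀) (simplex k (z₀ ∷ z₁ ∷ rest))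
    ≡⟨ count-simplex p k z₀ (z₁ ∷ rest) ⟨
  count p (simplex (suc k) (z₀ ∷ z₁ ∷ rest))      ≡⟨ simplex-swap (suc k) z₀ z₁ rest p ⟩
  count p (simplex (suc k) (z₁ ∷ z₀ ∷ rest))      ≡⟨ count-simplex p k z₁ (z₀ ∷ rest) ⟩
  count p (simplex (suc k) (z₀ ∷ rest)) + count (p ∘ ℤ._+_ z₁) (simplex k (z₁ ∷ z₀ ∷ rest))
    ≡⟨ cong (_+_ (count p (simplex (suc k) (z₀ ∷ rest)))) (simplex-swap k z₁ z₀ rest (p ∘ ℤ._+_ z₁)) ⟩
  count p (simplex (suc k) (z₀ ∷ rest)) + count (p ∘ ℤ._+_ z₁) (simplex k (z₀ ∷ z₁ ∷ rest)) ∎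
  where open ≡-Reasoning

-- Both faces complete the (n+1)-simplex on z₀ ∷ z₁ ∷ rest by a translate of the n-simplex,
-- and all translates of a balanced list have the same residue counts.
balanced⇒faces : ∀ q n z₀ z₁ rest → IsBalanced q (simplex n (z₀ ∷ z₁ ∷ rest)) →
  simplex (suc n) (z₁ ∷ rest) ≈ simplex (suc n) (z₀ ∷ rest) [mod q ]
balanced⇒faces q n z₀ z₁ rest bal c = ℕP.+-cancelʳ-≡ _ _ _ (begin
  count (inClass q c) (simplex (suc n) (z₁ ∷ rest)) + count (inClass q (c ℤ.- z₀)) Δ
    ≡⟨ cong (_+_ (count (inClass q c) (simplex (suc n) (z₁ ∷ rest)))) (count-translate q c z₀ Δ) ⟨
  count (inClass q c) (simplex (suc n) (z₁ ∷ rest)) + count (inClass q c ∘ ℤ._+_ z₀) Δ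
    ≡⟨ count-simplex-exchange (inClass q c) n z₀ z₁ rest ⟩
  count (inClass q c) (simplex (suc n) (z₀ ∷ rest)) + count (inClass q c ∘ ℤ._+_ z₁) Δ
    ≡⟨ cong (_+_ (count (inClass q c) (simplex (suc n) (z₀ ∷ rest))))
            (trans (count-translate q c z₁ Δ) (bal (c ℤ.- z₁) (c ℤ.- z₀))) ⟩
  count (inClass q c) (simplex (suc n) (z₀ ∷ rest)) + count (inClass q (c ℤ.- z₀)) Δ ∎)
  where
  open ≡-Reasoning
  Δ = simplex n (z₀ ∷ z₁ ∷ rest)

-- Obstructions to balance

all-congruent⇒unbalanced : ∀ q → 1 < q → ∀ n z₀ zs → All (λ z → + q ∣ℤ z ℤ.- z₀) zs →
  ¬ IsBalanced q (simplex n (z₀ ∷ zs))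
all-congruent⇒unbalanced q 1<q n z₀ zs zs≡z₀ bal = ℕP.<-irrefl (sym (trans (bal c (c ℤ.+ + 1)) miss)) hit
  where
  c = + n ℤ.* z₀
  hit : 0 < count (inClass q c) (simplex n (z₀ ∷ zs))
  hit = count-∈ (inClass q c) (simplex-vertex n z₀ zs) (dec-true (+ q ∣ℤ? c ℤ.- c) (∣x-x q c))
  miss : count (inClass q (c ℤ.+ + 1)) (simplex n (z₀ ∷ zs)) ≡ 0
  miss = count-none-congruent q (simplex-congruent q n (z₀ ∷ zs) (∣x-x q z₀ ∷ zs≡z₀)) (∤x-[x+1] 1<q c)

three-congruent⇒unbalanced : ∀ q n z₀ z₁ z₂ z₃ → + q ∣ℤ z₁ ℤ.- z₀ → + q ∣ℤ z₂ ℤ.- z₀ → ¬ + q ∣ℤ z₃ ℤ.- z₀ →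
  ¬ IsBalanced q (simplex n (z₀ ∷ z₁ ∷ z₂ ∷ z₃ ∷ []))
three-congruent⇒unbalanced q n z₀ z₁ z₂ z₃ z₁≡z₀ z₂≡z₀ z₃≢z₀ bal =
  ℕP.<-irrefl (sym (trans (sym (faces c)) miss)) hit
  where
  faces : simplex (suc n) (z₀ ∷ z₁ ∷ z₂ ∷ []) ≈ simplex (suc n) (z₃ ∷ z₁ ∷ z₂ ∷ []) [mod q ]
  faces = balanced⇒faces q n z₃ z₀ (z₁ ∷ z₂ ∷ [])
    (↭-isBalanced q n (shift z₃ (z₀ ∷ z₁ ∷ z₂ ∷ []) []) bal)
  c = z₃ ℤ.+ + n ℤ.* z₁
  hit : 0 < count (inClass q c) (simplex (suc n) (z₃ ∷ z₁ ∷ z₂ ∷ []))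
  hit = count-∈ (inClass q c)
    (∈-++⁺ʳ (simplex (suc n) (z₁ ∷ z₂ ∷ [])) (∈-map⁺ (ℤ._+_ z₃) (simplex-⊆ n z₃ (simplex-vertex n z₁ (z₂ ∷ [])))))
    (dec-true (+ q ∣ℤ? c ℤ.- c) (∣x-x q c))
  rearrange : ∀ z₀ z₁ z₃ n → (z₀ ℤ.+ n ℤ.* z₀) ℤ.- (z₃ ℤ.+ n ℤ.* z₁) ℤ.+ n ℤ.* (z₁ ℤ.- z₀) ≡ ℤ.- (z₃ ℤ.- z₀)
  rearrange = solve-∀
  z₃≢c : ¬ + q ∣ℤ + suc n ℤ.* z₀ ℤ.- c
  z₃≢c q∣ = z₃≢z₀ (subst (+ q ∣ℤ_) (ℤP.neg-involutive (z₃ ℤ.- z₀)) (∣m⇒∣-m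
    (subst (+ q ∣ℤ_) (trans (cong (λ x → x ℤ.- c ℤ.+ + n ℤ.* (z₁ ℤ.- z₀)) (ℤP.suc-* (+ n) z₀)) (rearrange z₀ z₁ z₃ (+ n)))
      (∣m∣n⇒∣m+n q∣ (∣n⇒∣m*n (+ n) z₁≡z₀)))))
  miss : count (inClass q c) (simplex (suc n) (z₀ ∷ z₁ ∷ z₂ ∷ [])) ≡ 0
  miss = count-none-congruent q (simplex-congruent q (suc n) (z₀ ∷ z₁ ∷ z₂ ∷ []) (∣x-x q z₀ ∷ z₁≡z₀ ∷ z₂≡z₀ ∷ [])) z₃≢c

+-cross : ∀ x y z w a b → x + a ≡ y + b → z + a ≡ w + b → x + w ≡ y + z
+-cross x y z w a b e e' = ℕP.+-cancelʳ-≡ (a + b) (x + w) (y + z) (begin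
  x + w + (a + b)     ≡⟨ regroup x w a b ⟩
  (x + a) + (w + b)   ≡⟨ cong₂ _+_ e (sym e') ⟩
  (y + b) + (z + a)   ≡⟨ regroup′ y b z a ⟩
  y + z + (a + b)     ∎)
  where
  open ≡-Reasoning
  regroup : ∀ x w a b → x + w + (a + b) ≡ (x + a) + (w + b)
  regroup = ℕSolver.solve-∀
  regroup′ : ∀ y b z a → (y + b) + (z + a) ≡ y + z + (a + b)
  regroup′ = ℕSolver.solve-∀

-- Subtracting the exchange identities of the two faces leaves an identity between four edges.
faces⇒edges : ∀ q k u v R R' → simplex k (u ∷ v ∷ R) ≈ simplex k (u ∷ v ∷ R') [mod q ] → ∀ c →
  count (inClass q c) (simplex (suc k) (v ∷ R)) + count (inClass q c) (simplex (suc k) (u ∷ R')) ≡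
  count (inClass q c) (simplex (suc k) (u ∷ R)) + count (inClass q c) (simplex (suc k) (v ∷ R'))
faces⇒edges q k u v R R' faces c = +-cross
  (count p (simplex (suc k) (v ∷ R))) (count p (simplex (suc k) (u ∷ R)))
  (count p (simplex (suc k) (v ∷ R'))) (count p (simplex (suc k) (u ∷ R')))
  (count (p ∘ ℤ._+_ u) Δ) (count (p ∘ ℤ._+_ v) Δ) (count-simplex-exchange p k u v R)
  (subst₂ (λ a b → count p (simplex (suc k) (v ∷ R')) + a ≡ count p (simplex (suc k) (u ∷ R')) + b)
    (sym (translates u)) (sym (translates v)) (count-simplex-exchange p k u v R'))
  where
  p = inClass q c
  Δ = simplex k (u ∷ v ∷ R)
  translates : ∀ z → count (p ∘ ℤ._+_ z) (simplex k (u ∷ v ∷ R)) ≡ count (p ∘ ℤ._+_ z) (simplex k (u ∷ v ∷ R'))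
  translates z = trans (count-translate q c z Δ)
    (trans (faces (c ℤ.- z)) (sym (count-translate q c z (simplex k (u ∷ v ∷ R')))))

multiples : ℕ → ℕ → ℕ
multiples q zero    = 1
multiples q (suc k) = 𝟙 (does (q ℕD.∣? suc k)) + multiples q k

multiples-divMod : ∀ q → 0 < q → ∀ k → ∃₂ λ t r → multiples q k ≡ suc t × r < q × t * q + r ≡ k
multiples-divMod q 0<q zero = 0 , 0 , refl , 0<q , refl
multiples-divMod q 0<q (suc k) with multiples-divMod q 0<q k | q ℕD.∣? suc k
... | t , r , M≡ , r<q , k≡ | yes q∣k+1 = suc t , 0 , cong suc M≡ , 0<q , (begin
  suc t * q + 0       ≡⟨ step t q ⟩
  t * q + q           ≡⟨ cong (_+_ (t * q)) r+1≡q ⟨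
  t * q + suc r       ≡⟨ ℕP.+-suc (t * q) r ⟩
  suc (t * q + r)     ≡⟨ cong suc k≡ ⟩
  suc k               ∎)
  where
  open ≡-Reasoning
  step : ∀ t q → suc t * q + 0 ≡ t * q + q
  step = ℕSolver.solve-∀
  r+1≡q : suc r ≡ q
  r+1≡q = ℕP.≤-antisym r<q (ℕD.∣⇒≤ (ℕD.∣m+n∣m⇒∣n
    (subst (q ∣_) (trans (cong suc (sym k≡)) (sym (ℕP.+-suc (t * q) r))) q∣k+1) (ℕD.n∣m*n t)))
... | t , r , M≡ , r<q , k≡ | no q∤k+1 = t , suc r , M≡ , r+1<q , trans (ℕP.+-suc (t * q) r) (cong suc k≡)
  where
  r+1<q : suc r < q
  r+1<q with ℕP.m≤n⇒m<n∨m≡n r<q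
  ... | inj₁ r+1<q = r+1<q
  ... | inj₂ r+1≡q = contradiction (subst (q ∣_)
    (trans (cong (λ x → t * q + x) (sym r+1≡q)) (trans (ℕP.+-suc (t * q) r) (cong suc k≡)))
    (subst (q ∣_) (ℕP.+-comm q (t * q)) (ℕD.n∣m*n (suc t)))) q∤k+1

-- With k = tq + r the identity reads tq + r + c = 2t + 1, which forces t = 0 as q ≥ 3 and
-- r + c ≥ 1, and then k ≤ 1.
twice-multiples≢ : ∀ q k c → 3 ≤ q → 2 ≤ k → (q ∣ k → 1 ≤ c) → multiples q k + multiples q k ≢ suc k + c
twice-multiples≢ q k c 3≤q 2≤k q∣k⇒c eq with multiples-divMod q (ℕP.<-trans (s≤s z≤n) 3≤q) k
... | t , r , M≡ , r<q , k≡ = ℕP.<⇒≱ (s≤s (s≤s z≤n)) (ℕP.≤-trans 2≤k (ℕP.≤-trans (ℕP.m≤m+n k c) k+c≤1))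
  where
  1≤r+c : 1 ≤ r + c
  1≤r+c = positive r k≡
    where
    positive : ∀ r → t * q + r ≡ k → 1 ≤ r + c
    positive (suc _) _  = s≤s z≤n
    positive zero    k≡ = q∣k⇒c (subst (q ∣_) (trans (sym (ℕP.+-identityʳ (t * q))) k≡) (ℕD.n∣m*n t))
  regroup : ∀ t q r c → suc (t * q + r) + c ≡ suc (t * q + (r + c))
  regroup = ℕSolver.solve-∀
  double : ∀ t → suc t + suc t ≡ suc (t + t + 1)
  double = ℕSolver.solve-∀
  E : t * q + (r + c) ≡ t + t + 1
  E = ℕP.suc-injective (trans (sym (regroup t q r c))
    (trans (cong (λ x → suc x + c) k≡) (trans (sym eq) (trans (cong₂ _+_ M≡ M≡) (double t)))))
  triple : ∀ t → t + t + t + 1 ≡ t * 3 + 1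
  triple = ℕSolver.solve-∀
  t≡0 : t ≡ 0
  t≡0 = ℕP.n≤0⇒n≡0 (ℕP.+-cancelˡ-≤ (t + t) t 0 (ℕP.+-cancelʳ-≤ 1 (t + t + t) (t + t + 0) (begin
    t + t + t + 1        ≡⟨ triple t ⟩
    t * 3 + 1            ≤⟨ ℕP.+-mono-≤ (ℕP.*-monoʳ-≤ t 3≤q) 1≤r+c ⟩
    t * q + (r + c)      ≡⟨ E ⟩
    t + t + 1            ≡⟨ cong (_+ 1) (ℕP.+-identityʳ (t + t)) ⟨
    t + t + 0 + 1        ∎)))
    where open ℕP.≤-Reasoning
  k+c≤1 : k + c ≤ 1
  k+c≤1 = ℕP.≤-reflexive (begin
    k + c                ≡⟨ cong (_+ c) k≡ ⟨
    t * q + r + c        ≡⟨ ℕP.+-assoc (t * q) r c ⟩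
    t * q + (r + c)      ≡⟨ E ⟩
    t + t + 1            ≡⟨ cong (λ x → x + x + 1) t≡0 ⟩
    1                    ∎)
    where open ≡-Reasoning

-- for a prime q this says q ∤ γ
Cancels : ℕ → ℤ → Set
Cancels q γ = ∀ i → + q ∣ℤ + i ℤ.* γ → q ∣ i

length-edge : ∀ k x y → length (simplex k (x ∷ y ∷ [])) ≡ suc k
length-edge zero    x y = refl
length-edge (suc k) x y = begin
  length (simplex (suc k) (y ∷ []) ++ map (ℤ._+_ x) (simplex k (x ∷ y ∷ [])))
    ≡⟨ LP.length-++ (simplex (suc k) (y ∷ [])) ⟩
  length (simplex (suc k) (y ∷ [])) + length (map (ℤ._+_ x) (simplex k (x ∷ y ∷ [])))
    ≡⟨ cong₂ _+_ (cong length (simplex-single (suc k) y)) (LP.length-map (ℤ._+_ x) (simplex k (x ∷ y ∷ []))) ⟩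
  suc (length (simplex k (x ∷ y ∷ [])))
    ≡⟨ cong suc (length-edge k x y) ⟩
  suc (suc k) ∎
  where open ≡-Reasoning

-- The point i x + (k - i) y of the edge is congruent to k x exactly when q ∣ k - i.
count-edge : ∀ q x y → Cancels q (y ℤ.- x) → ∀ k →
  count (inClass q (+ k ℤ.* x)) (simplex k (x ∷ y ∷ [])) ≡ multiples q k
count-edge q x y cancels zero = cong (λ b → 𝟙 b + 0) (dec-true (+ q ∣ℤ? + 0 ℤ.- + 0) (∣x-x q (+ 0)))
count-edge q x y cancels (suc k) = begin
  count p (simplex (suc k) (x ∷ y ∷ []))
    ≡⟨ count-simplex p k x (y ∷ []) ⟩
  count p (simplex (suc k) (y ∷ [])) + count (p ∘ ℤ._+_ x) E
    ≡⟨ cong₂ _+_ (cong (count p) (simplex-single (suc k) y)) (count-translate q (+ suc k ℤ.* x) x E) ⟩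
  𝟙 (p (+ suc k ℤ.* y)) + 0 + count (inClass q (+ suc k ℤ.* x ℤ.- x)) E
    ≡⟨ cong₂ _+_ (trans (ℕP.+-identityʳ _) (cong 𝟙 vertex)) (cong (λ c → count (inClass q c) E) shift-back) ⟩
  𝟙 (does (q ℕD.∣? suc k)) + count (inClass q (+ k ℤ.* x)) E
    ≡⟨ cong (_+_ (𝟙 (does (q ℕD.∣? suc k)))) (count-edge q x y cancels k) ⟩
  multiples q (suc k) ∎
  where
  open ≡-Reasoning
  p = inClass q (+ suc k ℤ.* x)
  E = simplex k (x ∷ y ∷ [])
  factor : ∀ k x y → k ℤ.* y ℤ.- k ℤ.* x ≡ k ℤ.* (y ℤ.- x)
  factor = solve-∀
  vertex : p (+ suc k ℤ.* y) ≡ does (q ℕD.∣? suc k)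
  vertex = does-⇔ (mk⇔ (λ q∣ → cancels (suc k) (subst (+ q ∣ℤ_) (factor (+ suc k) x y) q∣))
                       (λ q∣k+1 → subst (+ q ∣ℤ_) (sym (factor (+ suc k) x y))
                                    (∣m⇒∣m*n (y ℤ.- x) (∣ᵤ⇒∣ {i = + suc k} q∣k+1))))
    (+ q ∣ℤ? + suc k ℤ.* y ℤ.- + suc k ℤ.* x) (q ℕD.∣? suc k)
  shift-back : + suc k ℤ.* x ℤ.- x ≡ + k ℤ.* x
  shift-back = trans (cong (ℤ._- x) (ℤP.suc-* (+ k) x)) (cancel x (+ k ℤ.* x))
    where
    cancel : ∀ x y → x ℤ.+ y ℤ.- x ≡ y
    cancel = solve-∀

-- Ordering the vertices z₁ z₂ | z₀ z₃, the two faces through z₁ z₂ have the same residue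
-- counts, hence so do the pairs of opposite edges {z₂z₀, z₁z₃} and {z₁z₀, z₂z₃}; counted at the
-- class of K z₀ the first pair gives two multiples-counts and the second at least K + 1.
two-congruent⇒unbalanced : ∀ q → 3 ≤ q → ∀ n z₀ z₁ z₂ z₃ → + q ∣ℤ z₁ ℤ.- z₀ →
  Cancels q (z₂ ℤ.- z₀) → Cancels q (z₃ ℤ.- z₀) → ¬ IsBalanced q (simplex n (z₀ ∷ z₁ ∷ z₂ ∷ z₃ ∷ []))
two-congruent⇒unbalanced q 3≤q n z₀ z₁ z₂ z₃ z₁≡z₀ cancels₂ cancels₃ bal =
  twice-multiples≢ q K (count p (edge z₂ z₃)) 3≤q (s≤s (s≤s z≤n)) hit₂₃ (begin
    multiples q K + multiples q K                ≡⟨ cong₂ _+_ count₂₀ count₁₃ ⟨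
    count p (edge z₂ z₀) + count p (edge z₁ z₃)  ≡⟨ edges ⟩
    count p (edge z₁ z₀) + count p (edge z₂ z₃)  ≡⟨ cong (_+ count p (edge z₂ z₃)) count₁₀ ⟩
    suc K + count p (edge z₂ z₃)                 ∎)
  where
  open ≡-Reasoning
  K = suc (suc n)
  edge : ℤ → ℤ → List ℤ
  edge x y = simplex K (x ∷ y ∷ [])
  c₀ = + K ℤ.* z₀
  p = inClass q c₀
  factor : ∀ k x y → k ℤ.* y ℤ.- k ℤ.* x ≡ k ℤ.* (y ℤ.- x)
  factor = solve-∀
  faces : simplex (suc n) (z₁ ∷ z₂ ∷ z₀ ∷ []) ≈ simplex (suc n) (z₁ ∷ z₂ ∷ z₃ ∷ []) [mod q ]
  faces c = trans (simplex-↭ (shift z₀ (z₁ ∷ z₂ ∷ []) []) (suc n) (inClass q c))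
    (trans (balanced⇒faces q n z₃ z₀ (z₁ ∷ z₂ ∷ []) (↭-isBalanced q n (shift z₃ (z₀ ∷ z₁ ∷ z₂ ∷ []) []) bal) c)
      (sym (simplex-↭ (shift z₃ (z₁ ∷ z₂ ∷ []) []) (suc n) (inClass q c))))
  edges : count p (edge z₂ z₀) + count p (edge z₁ z₃) ≡ count p (edge z₁ z₀) + count p (edge z₂ z₃)
  edges = faces⇒edges q (suc n) z₁ z₂ (z₀ ∷ []) (z₃ ∷ []) faces c₀
  count₂₀ : count p (edge z₂ z₀) ≡ multiples q K
  count₂₀ = trans (simplex-swap K z₂ z₀ [] p) (count-edge q z₀ z₂ cancels₂ K)
  cancels₁₃ : Cancels q (z₃ ℤ.- z₁)
  cancels₁₃ i q∣ = cancels₃ i (subst (+ q ∣ℤ_) (telescope (+ i) z₀ z₁ z₃) (∣m∣n⇒∣m+n q∣ (∣n⇒∣m*n (+ i) z₁≡z₀)))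
    where
    telescope : ∀ i z₀ z₁ z₃ → i ℤ.* (z₃ ℤ.- z₁) ℤ.+ i ℤ.* (z₁ ℤ.- z₀) ≡ i ℤ.* (z₃ ℤ.- z₀)
    telescope = solve-∀
  count₁₃ : count p (edge z₁ z₃) ≡ multiples q K
  count₁₃ = trans (count-cong (λ t → inClass-cong q t c₀ t (+ K ℤ.* z₁)
                    (subst (+ q ∣ℤ_) (sym (swap-sub t)) (∣n⇒∣m*n (+ K) z₁≡z₀))) (edge z₁ z₃))
                  (count-edge q z₁ z₃ cancels₁₃ K)
    where
    swap-sub : ∀ t → (t ℤ.- c₀) ℤ.- (t ℤ.- + K ℤ.* z₁) ≡ + K ℤ.* (z₁ ℤ.- z₀)
    swap-sub t = trans (cancel t c₀ (+ K ℤ.* z₁)) (factor (+ K) z₀ z₁)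
      where
      cancel : ∀ t a b → (t ℤ.- a) ℤ.- (t ℤ.- b) ≡ b ℤ.- a
      cancel = solve-∀
  count₁₀ : count p (edge z₁ z₀) ≡ suc K
  count₁₀ = trans (count-all p (All.map (λ {t} → dec-true (+ q ∣ℤ? t ℤ.- c₀))
                                        (simplex-congruent q K (z₁ ∷ z₀ ∷ []) (z₁≡z₀ ∷ ∣x-x q z₀ ∷ []))))
                  (length-edge K z₁ z₀)
  hit₂₃ : q ∣ K → 1 ≤ count p (edge z₂ z₃)
  hit₂₃ q∣K = count-∈ p (simplex-⊆ K z₂ {z₃ ∷ []} (simplex-vertex K z₃ []))
    (dec-true (+ q ∣ℤ? + K ℤ.* z₃ ℤ.- c₀)
      (subst (+ q ∣ℤ_) (sym (factor (+ K) z₀ z₃)) (∣m⇒∣m*n (z₃ ℤ.- z₀) (∣ᵤ⇒∣ {i = + K} q∣K))))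

∑< : ℕ → (ℕ → ℕ) → ℕ
∑< zero    f = 0
∑< (suc n) f = f 0 + ∑< n (f ∘ suc)

∑<-cong : ∀ n {f g} → (∀ i → i < n → f i ≡ g i) → ∑< n f ≡ ∑< n g
∑<-cong zero    f≗g = refl
∑<-cong (suc n) f≗g = cong₂ _+_ (f≗g 0 (s≤s z≤n)) (∑<-cong n (λ i i<n → f≗g (suc i) (s≤s i<n)))

∑<-zero : ∀ n {f} → (∀ i → i < n → f i ≡ 0) → ∑< n f ≡ 0
∑<-zero zero    f≡0 = refl
∑<-zero (suc n) f≡0 = cong₂ _+_ (f≡0 0 (s≤s z≤n)) (∑<-zero n (λ i i<n → f≡0 (suc i) (s≤s i<n)))

∑<-truncate : ∀ n k {f} → k ≤ n → (∀ i → k ≤ i → i < n → f i ≡ 0) → ∑< n f ≡ ∑< k f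
∑<-truncate n       zero    z≤n       f≡0 = ∑<-zero n (λ i → f≡0 i z≤n)
∑<-truncate (suc n) (suc k) (s≤s k≤n) f≡0 =
  cong (_+_ _) (∑<-truncate n k k≤n (λ i k≤i i<n → f≡0 (suc i) (s≤s k≤i) (s≤s i<n)))

∑<-+ : ∀ n (f g : ℕ → ℕ) → ∑< n (λ i → f i + g i) ≡ ∑< n f + ∑< n g
∑<-+ zero    f g = refl
∑<-+ (suc n) f g = trans (cong (_+_ (f 0 + g 0)) (∑<-+ n (f ∘ suc) (g ∘ suc)))
  (interchange (f 0) (g 0) (∑< n (f ∘ suc)) (∑< n (g ∘ suc)))
  where
  interchange : ∀ a b c d → a + b + (c + d) ≡ a + c + (b + d)
  interchange = ℕSolver.solve-∀

∑<-*ʳ : ∀ n (f : ℕ → ℕ) c → ∑< n (λ i → f i * c) ≡ ∑< n f * c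
∑<-*ʳ zero    f c = refl
∑<-*ʳ (suc n) f c = trans (cong (_+_ (f 0 * c)) (∑<-*ʳ n (f ∘ suc) c)) (sym (ℕP.*-distribʳ-+ c (f 0) _))

∑<-indicator : ∀ n (f : ℕ → ℕ) k → k < n → ∑< n (λ i → f i * 𝟙 (does (k ℕ.≟ i))) ≡ f k
∑<-indicator (suc n) f zero    _         =
  trans (cong₂ _+_ (ℕP.*-identityʳ (f 0)) (∑<-zero n (λ i _ → ℕP.*-zeroʳ (f (suc i))))) (ℕP.+-identityʳ (f 0))
∑<-indicator (suc n) f (suc k) (s≤s k<n) =
  trans (cong (_+ ∑< n (λ i → f (suc i) * 𝟙 (does (k ℕ.≟ i)))) (ℕP.*-zeroʳ (f 0))) (∑<-indicator n (f ∘ suc) k k<n)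

∑<-rotate : ∀ n (f : ℕ → ℕ) → ∑< n (f ∘ suc) + f 0 ≡ ∑< n f + f n
∑<-rotate zero    f = refl
∑<-rotate (suc n) f = begin
  f 1 + ∑< n (f ∘ suc ∘ suc) + f 0      ≡⟨ cong (_+ f 0) (ℕP.+-comm (f 1) _) ⟩
  ∑< n (f ∘ suc ∘ suc) + f 1 + f 0      ≡⟨ cong (_+ f 0) (∑<-rotate n (f ∘ suc)) ⟩
  ∑< n (f ∘ suc) + f (suc n) + f 0      ≡⟨ rotate (∑< n (f ∘ suc)) (f (suc n)) (f 0) ⟩
  f 0 + ∑< n (f ∘ suc) + f (suc n)      ∎
  where
  open ≡-Reasoning
  rotate : ∀ a b c → a + b + c ≡ c + a + b
  rotate = ℕSolver.solve-∀

-- The tetrahedron as a simplex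

module _ {A : Set} where

  count-filter : ∀ {P : Pred A 0ℓ} (P? : Decidable P) p xs →
    count p (filter P? xs) ≡ count (λ x → does (P? x) ∧ p x) xs
  count-filter P? p []       = refl
  count-filter P? p (x ∷ xs) with does (P? x)
  ... | true  = cong (_+_ (𝟙 (p x))) (count-filter P? p xs)
  ... | false = count-filter P? p xs

  length-filter : ∀ {P : Pred A 0ℓ} (P? : Decidable P) xs → length (filter P? xs) ≡ count (λ x → does (P? x)) xs
  length-filter P? []       = refl
  length-filter P? (x ∷ xs) with does (P? x)
  ... | true  = cong suc (length-filter P? xs)
  ... | false = length-filter P? xs

  count-applyUpTo : ∀ (p : A → Bool) φ n → count p (applyUpTo φ n) ≡ ∑< n (λ i → 𝟙 (p (φ i)))
  count-applyUpTo p φ zero    = refl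
  count-applyUpTo p φ (suc n) = cong (_+_ (𝟙 (p (φ 0)))) (count-applyUpTo p (φ ∘ suc) n)

  count-concatMap : ∀ {B : Set} (p : A → Bool) (F : B → List A) φ n →
    count p (concatMap F (applyUpTo φ n)) ≡ ∑< n (λ i → count p (F (φ i)))
  count-concatMap p F φ zero    = refl
  count-concatMap p F φ (suc n) =
    trans (count-++ p (F (φ 0)) _) (cong (_+_ (count p (F (φ 0)))) (count-concatMap p F (φ ∘ suc) n))

count-triples : ∀ (p : ℕ × ℕ × ℕ → Bool) s → count p (triples s) ≡
  ∑< s (λ i → ∑< s (λ j → ∑< s (λ k → 𝟙 (does (i + j + k <? s) ∧ p (i , j , k)))))
count-triples p s = trans (count-filter _ p cube) (trans (count-concatMap p′ _ (λ i → i) s)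
  (∑<-cong s (λ i _ → trans (count-concatMap p′ _ (λ j → j) s)
    (∑<-cong s (λ j _ → trans (count-map p′ (λ k → i , j , k) (upTo s)) (count-applyUpTo _ (λ k → k) s))))))
  where
  cube = concatMap (λ i → concatMap (λ j → map (λ k → i , j , k) (upTo s)) (upTo s)) (upTo s)
  p′ : ℕ × ℕ × ℕ → Bool
  p′ (i , j , k) = does (i + j + k <? s) ∧ p (i , j , k)

count-simplex-by-vertex : ∀ (p : ℤ → Bool) k z zs →
  count p (simplex k (z ∷ zs)) ≡ ∑< (suc k) (λ i → count (p ∘ ℤ._+_ (+ i ℤ.* z)) (simplex (k ∸ i) zs))
count-simplex-by-vertex p zero    z zs = sym (ℕP.+-identityʳ (𝟙 (p (+ 0)) + 0))
count-simplex-by-vertex p (suc k) z zs = trans (count-simplex p k z zs) (cong₂ _+_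
  (count-cong (λ t → cong p (sym (ℤP.+-identityˡ t))) (simplex (suc k) zs))
  (trans (count-simplex-by-vertex (p ∘ ℤ._+_ z) k z zs)
    (∑<-cong (suc k) (λ i _ → count-cong (λ t → cong p (step z (+ i) t)) (simplex (k ∸ i) zs)))))
  where
  step : ∀ z i t → z ℤ.+ (i ℤ.* z ℤ.+ t) ≡ (ℤ.1ℤ ℤ.+ i) ℤ.* z ℤ.+ t
  step = solve-∀

vertices : ℤ → ℤ → ℤ → List ℤ
vertices d₁ d₂ d₃ = d₁ ∷ d₂ ∷ d₃ ∷ + 0 ∷ []

count-tetrahedron : ∀ (p : ℤ → Bool) a d₁ d₂ d₃ n → count (p ∘ ℤ._+_ a) (simplex n (vertices d₁ d₂ d₃)) ≡
  ∑< (suc n) (λ i → ∑< (suc (n ∸ i)) (λ j → ∑< (suc (n ∸ i ∸ j)) (λ k → 𝟙 (p (term a d₁ d₂ d₃ (i , j , k))))))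
count-tetrahedron p a d₁ d₂ d₃ n =
  trans (count-simplex-by-vertex f₀ n d₁ _) (∑<-cong (suc n) λ i _ →
  trans (count-simplex-by-vertex (f₁ i) (n ∸ i) d₂ _) (∑<-cong (suc (n ∸ i)) λ j _ →
  trans (count-simplex-by-vertex (f₂ i j) (n ∸ i ∸ j) d₃ _) (∑<-cong (suc (n ∸ i ∸ j)) λ k _ →
  trans (cong (count (f₃ i j k)) (simplex-single (n ∸ i ∸ j ∸ k) (+ 0)))
        (trans (ℕP.+-identityʳ _) (cong (𝟙 ∘ p) (regroup a d₁ d₂ d₃ (+ i) (+ j) (+ k) (+ (n ∸ i ∸ j ∸ k))))))))
  where
  f₀ : ℤ → Bool
  f₀ = p ∘ ℤ._+_ a
  f₁ : ℕ → ℤ → Bool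
  f₁ i = f₀ ∘ ℤ._+_ (+ i ℤ.* d₁)
  f₂ : ℕ → ℕ → ℤ → Bool
  f₂ i j = f₁ i ∘ ℤ._+_ (+ j ℤ.* d₂)
  f₃ : ℕ → ℕ → ℕ → ℤ → Bool
  f₃ i j k = f₂ i j ∘ ℤ._+_ (+ k ℤ.* d₃)
  regroup : ∀ a d₁ d₂ d₃ i j k r →
    a ℤ.+ (i ℤ.* d₁ ℤ.+ (j ℤ.* d₂ ℤ.+ (k ℤ.* d₃ ℤ.+ r ℤ.* + 0))) ≡ a ℤ.+ i ℤ.* d₁ ℤ.+ j ℤ.* d₂ ℤ.+ k ℤ.* d₃
  regroup = solve-∀

module _ {n i j k : ℕ} where

  <suc⇒≤∸ : i + j + k < suc n → j ≤ n ∸ i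
  <suc⇒≤∸ (s≤s ijk≤n) = ℕP.m+n≤o⇒m≤o∸n j (subst (_≤ n) (ℕP.+-comm i j) (ℕP.≤-trans (ℕP.m≤m+n (i + j) k) ijk≤n))

  <suc⇒≤∸∸ : i + j + k < suc n → k ≤ n ∸ i ∸ j
  <suc⇒≤∸∸ (s≤s ijk≤n) =
    subst (k ≤_) (sym (ℕP.∸-+-assoc n i j)) (ℕP.m+n≤o⇒m≤o∸n k (subst (_≤ n) (ℕP.+-comm (i + j) k) ijk≤n))

  ≤∸∸⇒<suc : i ≤ n → j ≤ n ∸ i → k ≤ n ∸ i ∸ j → i + j + k < suc n
  ≤∸∸⇒<suc i≤n j≤n-i k≤n-i-j = s≤s (subst (_≤ n) (ℕP.+-comm k (i + j))
    (ℕP.m≤o∸n⇒m+n≤o k (subst (_≤ n) (ℕP.+-comm j i) (ℕP.m≤o∸n⇒m+n≤o j i≤n j≤n-i))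
      (subst (k ≤_) (ℕP.∸-+-assoc n i j) k≤n-i-j)))

cube-sum≡simplex-sum : ∀ n (E : ℕ → ℕ → ℕ → Bool) →
  ∑< (suc n) (λ i → ∑< (suc n) (λ j → ∑< (suc n) (λ k → 𝟙 (does (i + j + k <? suc n) ∧ E i j k)))) ≡
  ∑< (suc n) (λ i → ∑< (suc (n ∸ i)) (λ j → ∑< (suc (n ∸ i ∸ j)) (λ k → 𝟙 (E i j k))))
cube-sum≡simplex-sum n E = ∑<-cong (suc n) λ i i<n+1 →
  trans (∑<-truncate (suc n) (suc (n ∸ i)) {λ j → ∑< (suc n) (λ k → summand i j k)} (s≤s (ℕP.m∸n≤m n i))
          (λ j n-i<j _ → ∑<-zero (suc n)
            (λ k _ → outside {i} {j} {k} (λ ijk<n+1 → ℕP.<⇒≱ n-i<j (<suc⇒≤∸ {n} {i} {j} {k} ijk<n+1)))))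
  (∑<-cong (suc (n ∸ i)) λ j j<n-i+1 →
  trans (∑<-truncate (suc n) (suc (n ∸ i ∸ j)) {summand i j} (s≤s (ℕP.≤-trans (ℕP.m∸n≤m (n ∸ i) j) (ℕP.m∸n≤m n i)))
          (λ k n-i-j<k _ → outside {i} {j} {k} (λ ijk<n+1 → ℕP.<⇒≱ n-i-j<k (<suc⇒≤∸∸ {n} {i} {j} {k} ijk<n+1))))
  (∑<-cong (suc (n ∸ i ∸ j)) λ k k<n-i-j+1 →
    cong (λ b → 𝟙 (b ∧ E i j k))
      (dec-true (i + j + k <? suc n) (≤∸∸⇒<suc (pred-≤ i<n+1) (pred-≤ j<n-i+1) (pred-≤ k<n-i-j+1)))))
  where
  summand : ℕ → ℕ → ℕ → ℕ
  summand i j k = 𝟙 (does (i + j + k <? suc n) ∧ E i j k)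
  pred-≤ : ∀ {x y} → x < suc y → x ≤ y
  pred-≤ (s≤s x≤y) = x≤y
  outside : ∀ {i j k} → ¬ i + j + k < suc n → summand i j k ≡ 0
  outside {i} {j} {k} ¬ijk<n+1 = cong (λ b → 𝟙 (b ∧ E i j k)) (dec-false (i + j + k <? suc n) ¬ijk<n+1)

count-terms : ∀ (p : ℤ → Bool) a d₁ d₂ d₃ n →
  count (p ∘ term a d₁ d₂ d₃) (triples (suc n)) ≡ count (p ∘ ℤ._+_ a) (simplex n (vertices d₁ d₂ d₃))
count-terms p a d₁ d₂ d₃ n = trans (count-triples (p ∘ term a d₁ d₂ d₃) (suc n))
  (trans (cube-sum≡simplex-sum n (λ i j k → p (term a d₁ d₂ d₃ (i , j , k)))) (sym (count-tetrahedron p a d₁ d₂ d₃ n)))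

-- Balance modulo divisors

hasResidue : (m : ℕ) .{{_ : NonZero m}} → ℕ → ℤ → Bool
hasResidue m r t = does (t %ℕ m ℕ.≟ r)

multiplicity≡count : ∀ m .{{_ : NonZero m}} a d₁ d₂ d₃ n (x : Fin m) → multiplicity m a d₁ d₂ d₃ (suc n) x ≡
  count (hasResidue m (toℕ x)) (map (ℤ._+_ a) (simplex n (vertices d₁ d₂ d₃)))
multiplicity≡count m a d₁ d₂ d₃ n x =
  trans (length-filter (λ i → term a d₁ d₂ d₃ i %ℕ m ℕ.≟ toℕ x) (triples (suc n)))
    (trans (count-terms (hasResidue m (toℕ x)) a d₁ d₂ d₃ n)
      (sym (count-map (hasResidue m (toℕ x)) (ℤ._+_ a) (simplex n (vertices d₁ d₂ d₃)))))

count-by-residues : ∀ m .{{_ : NonZero m}} (p : ℤ → Bool) → (∀ t → p t ≡ p (+ (t %ℕ m))) → ∀ L →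
  count p L ≡ ∑< m (λ r → 𝟙 (p (+ r)) * count (hasResidue m r) L)
count-by-residues m p p-mod []      = sym (∑<-zero m (λ r _ → ℕP.*-zeroʳ (𝟙 (p (+ r)))))
count-by-residues m p p-mod (t ∷ L) = begin
  𝟙 (p t) + count p L
    ≡⟨ cong₂ _+_ (trans (cong 𝟙 (p-mod t)) (sym (∑<-indicator m (λ r → 𝟙 (p (+ r))) (t %ℕ m) (n%ℕd<d t m))))
                 (count-by-residues m p p-mod L) ⟩
  ∑< m (λ r → 𝟙 (p (+ r)) * 𝟙 (hasResidue m r t)) + ∑< m (λ r → 𝟙 (p (+ r)) * count (hasResidue m r) L)
    ≡⟨ ∑<-+ m _ _ ⟨
  ∑< m (λ r → 𝟙 (p (+ r)) * 𝟙 (hasResidue m r t) + 𝟙 (p (+ r)) * count (hasResidue m r) L)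
    ≡⟨ ∑<-cong m (λ r _ → sym (ℕP.*-distribˡ-+ (𝟙 (p (+ r))) _ _)) ⟩
  ∑< m (λ r → 𝟙 (p (+ r)) * count (hasResidue m r) (t ∷ L)) ∎
  where open ≡-Reasoning

module _ (m : ℕ) .{{_ : NonZero m}} (q : ℕ) (q∣m : q ∣ m) where

  classSize : ℤ → ℕ
  classSize c = ∑< m (λ r → 𝟙 (inClass q c (+ r)))

  -- The residues 0, …, m - 1 shifted by one are 1, …, m, and m lies in the class of 0.
  classSize-pred : ∀ c → classSize (c ℤ.- + 1) ≡ classSize c
  classSize-pred c = trans (∑<-cong m (λ r _ → cong 𝟙 (inClass-diff q {+ r} {c ℤ.- + 1} {+ suc r} {c} (move (+ r) c))))
    (ℕP.+-cancelʳ-≡ (g 0) _ _ (trans (∑<-rotate m g) (cong (_+_ (∑< m g)) g[m]≡g[0])))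
    where
    move : ∀ r c → r ℤ.- (c ℤ.- + 1) ≡ (+ 1 ℤ.+ r) ℤ.- c
    move = solve-∀
    g : ℕ → ℕ
    g r = 𝟙 (inClass q c (+ r))
    cancel : ∀ m c → (m ℤ.- c) ℤ.- (+ 0 ℤ.- c) ≡ m
    cancel = solve-∀
    g[m]≡g[0] : g m ≡ g 0
    g[m]≡g[0] = cong 𝟙 (inClass-cong q (+ m) c (+ 0) c (subst (+ q ∣ℤ_) (sym (cancel (+ m) c)) (∣ᵤ⇒∣ q∣m)))

  classSize-const : ∀ c c' → classSize c ≡ classSize c'
  classSize-const c c' = trans (≡classSize0 c) (sym (≡classSize0 c'))
    where
    step : ∀ k → + suc k ℤ.- + 1 ≡ + k
    step k = ℤP.m-n≡m⊖n (suc k) 1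
    ≡classSize0 : ∀ c → classSize c ≡ classSize (+ 0)
    ≡classSize0 (+ zero)      = refl
    ≡classSize0 (+ suc k)     = trans (sym (classSize-pred (+ suc k))) (trans (cong classSize (step k)) (≡classSize0 (+ k)))
    ≡classSize0 ℤ.-[1+ zero ]  = classSize-pred (+ 0)
    ≡classSize0 ℤ.-[1+ suc k ] = trans (cong classSize (sym (pred-negsuc k)))
      (trans (classSize-pred ℤ.-[1+ k ]) (≡classSize0 ℤ.-[1+ k ]))
      where
      pred-negsuc : ∀ k → ℤ.-[1+ k ] ℤ.- + 1 ≡ ℤ.-[1+ suc k ]
      pred-negsuc k = cong (λ x → ℤ.-[1+ suc x ]) (ℕP.+-identityʳ k)

  inClass-mod : ∀ c t → inClass q c t ≡ inClass q c (+ (t %ℕ m))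
  inClass-mod c t = inClass-cong q t c (+ (t %ℕ m)) c (subst (+ q ∣ℤ_) (sym (cancel t c (+ (t %ℕ m))))
    (∣-trans (∣ᵤ⇒∣ {i = + m} q∣m) (q∣x-x%ℕq m t)))
    where
    cancel : ∀ t c r → (t ℤ.- c) ℤ.- (r ℤ.- c) ≡ t ℤ.- r
    cancel = solve-∀

  equidistributed⇒balanced : ∀ L C → (∀ r → r < m → count (hasResidue m r) L ≡ C) → IsBalanced q L
  equidistributed⇒balanced L C uniform c c' =
    trans (count-class c) (trans (cong (_* C) (classSize-const c c')) (sym (count-class c')))
    where
    count-class : ∀ c → count (inClass q c) L ≡ classSize c * C
    count-class c = trans (count-by-residues m (inClass q c) (inClass-mod c) L)
      (trans (∑<-cong m (λ r r<m → cong (_*_ (𝟙 (inClass q c (+ r)))) (uniform r r<m)))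
             (∑<-*ʳ m (λ r → 𝟙 (inClass q c (+ r))) C))

balanced⇒isBalanced : ∀ m .{{_ : NonZero m}} n a d₁ d₂ d₃ → Balanced m a d₁ d₂ d₃ (suc n) →
  ∀ q → q ∣ m → IsBalanced q (simplex n (vertices d₁ d₂ d₃))
balanced⇒isBalanced m n a d₁ d₂ d₃ bal q q∣m c c' = trans (untranslate c)
  (trans (equidistributed⇒balanced m q q∣m L C uniform (c ℤ.+ a) (c' ℤ.+ a)) (sym (untranslate c')))
  where
  G = simplex n (vertices d₁ d₂ d₃)
  L = map (ℤ._+_ a) G
  move : ∀ a t c → (a ℤ.+ t) ℤ.- (c ℤ.+ a) ≡ t ℤ.- c
  move = solve-∀
  untranslate : ∀ c → count (inClass q c) G ≡ count (inClass q (c ℤ.+ a)) L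
  untranslate c = sym (trans (count-map (inClass q (c ℤ.+ a)) (ℤ._+_ a) G)
    (count-cong (λ t → inClass-diff q {a ℤ.+ t} {c ℤ.+ a} {t} {c} (move a t c)) G))
  C = count (hasResidue m 0) L
  0<m : 0 < m
  0<m = ℕ.>-nonZero⁻¹ m
  uniform : ∀ r → r < m → count (hasResidue m r) L ≡ C
  uniform r r<m = begin
    count (hasResidue m r) L                           ≡⟨ cong (λ r → count (hasResidue m r) L) (FinP.toℕ-fromℕ< r<m) ⟨
    count (hasResidue m (toℕ (fromℕ< r<m))) L           ≡⟨ multiplicity≡count m a d₁ d₂ d₃ n (fromℕ< r<m) ⟨
    multiplicity m a d₁ d₂ d₃ (suc n) (fromℕ< r<m)      ≡⟨ bal (fromℕ< r<m) (fromℕ< 0<m) ⟩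
    multiplicity m a d₁ d₂ d₃ (suc n) (fromℕ< 0<m)      ≡⟨ multiplicity≡count m a d₁ d₂ d₃ n (fromℕ< 0<m) ⟩
    count (hasResidue m (toℕ (fromℕ< 0<m))) L           ≡⟨ cong (λ r → count (hasResidue m r) L) (FinP.toℕ-fromℕ< 0<m) ⟩
    C                                                 ∎
    where open ≡-Reasoning

-- Divisibility

prime-cancels : ∀ p → Prime p → ∀ γ → ¬ + p ∣ℤ γ → Cancels p γ
prime-cancels p p-prime γ p∤γ i p∣iγ
  with euclidsLemma i ∣ γ ∣ p-prime (subst (p ∣_) (ℤP.abs-* (+ i) γ) (∣⇒∣ᵤ p∣iγ))
... | inj₁ p∣i = p∣i
... | inj₂ p∣γ = contradiction (∣ᵤ⇒∣ p∣γ) p∤γ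

odd-cancels-4 : ∀ γ → ¬ + 2 ∣ℤ γ → Cancels 4 γ
odd-cancels-4 γ 2∤γ i 4∣iγ = 4∣i (2∣ i (ℕD.∣-trans (ℕD.n∣m*n 2) 4∣ig))
  where
  4∣ig : 4 ∣ i * ∣ γ ∣
  4∣ig = subst (4 ∣_) (ℤP.abs-* (+ i) γ) (∣⇒∣ᵤ 4∣iγ)
  2∣ : ∀ j → 2 ∣ j * ∣ γ ∣ → 2 ∣ j
  2∣ j 2∣jγ with euclidsLemma j ∣ γ ∣ prime[2] 2∣jγ
  ... | inj₁ 2∣j = 2∣j
  ... | inj₂ 2∣γ = contradiction (∣ᵤ⇒∣ 2∣γ) 2∤γ
  regroup : ∀ j g → j * 2 * g ≡ 2 * (j * g)
  regroup = ℕSolver.solve-∀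
  4∣i : 2 ∣ i → 4 ∣ i
  4∣i (ℕD.divides j i≡j*2) = subst (4 ∣_) (sym i≡j*2) (ℕD.*-monoˡ-∣ 2
    (2∣ j (ℕD.*-cancelˡ-∣ 2 (subst (4 ∣_) (trans (cong (_* ∣ γ ∣) i≡j*2) (regroup j ∣ γ ∣)) 4∣ig))))

odd-prime≥3 : ∀ p → Prime p → p ≢ 2 → 3 ≤ p
odd-prime≥3 p p-prime p≢2 = ℕP.≤∧≢⇒< (ℕ.nonTrivial⇒n>1 p {{prime⇒nonTrivial p-prime}}) (p≢2 ∘ sym)

prime-divisor : ∀ n → ∃ λ p → Prime p × p ∣ suc (suc n)
prime-divisor n with factorise (suc (suc n))
... | record { factors = []     ; isFactorisation = () }
... | record { factors = p ∷ ps ; isFactorisation = n≡Π ; factorsPrime = p-prime ∷ _ } =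
  p , p-prime , subst (p ∣_) (sym n≡Π) (ℕD.m∣m*n (product ps))

no-prime-divisor⇒≡1 : ∀ n → n ≢ 0 → (∀ p → Prime p → ¬ p ∣ n) → n ≡ 1
no-prime-divisor⇒≡1 zero          n≢0 _        = contradiction refl n≢0
no-prime-divisor⇒≡1 (suc zero)    _   _        = refl
no-prime-divisor⇒≡1 (suc (suc n)) _   no-prime with prime-divisor n
... | p , p-prime , p∣n = contradiction p∣n (no-prime p p-prime)

gcd≡1 : ∀ a m .{{_ : NonZero m}} → (∀ p → Prime p → p ∣ m → ¬ p ∣ a) → gcd a m ≡ 1
gcd≡1 a m coprime = no-prime-divisor⇒≡1 (gcd a m) (gcd[m,n]≢0 a m (inj₂ (ℕ.≢-nonZero⁻¹ m)))
  (λ p p-prime p∣g → coprime p p-prime (ℕD.∣-trans p∣g (gcd[m,n]∣n a m)) (ℕD.∣-trans p∣g (gcd[m,n]∣m a m)))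

gcd≡2 : ∀ a m .{{_ : NonZero m}} → 2 ∣ a → 2 ∣ m → (4 ∣ m → ¬ 4 ∣ a) →
  (∀ p → Prime p → p ≢ 2 → p ∣ m → ¬ p ∣ a) → gcd a m ≡ 2
gcd≡2 a m 2∣a 2∣m 4∤ odd-coprime with gcd-greatest 2∣a 2∣m
... | ℕD.divides h g≡h*2 = trans g≡h*2 (cong (_* 2) (no-prime-divisor⇒≡1 h h≢0 no-prime))
  where
  g = gcd a m
  h≢0 : h ≢ 0
  h≢0 h≡0 = gcd[m,n]≢0 a m (inj₂ (ℕ.≢-nonZero⁻¹ m)) (trans g≡h*2 (cong (_* 2) h≡0))
  common : ∀ {d} → d ∣ g → (d ∣ m) × (d ∣ a)
  common d∣g = ℕD.∣-trans d∣g (gcd[m,n]∣n a m) , ℕD.∣-trans d∣g (gcd[m,n]∣m a m)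
  no-prime : ∀ p → Prime p → ¬ p ∣ h
  no-prime p p-prime p∣h with p ℕ.≟ 2 | common (subst (p * 2 ∣_) (sym g≡h*2) (ℕD.*-monoˡ-∣ 2 p∣h))
  ... | yes refl | 4∣m , 4∣a = 4∤ 4∣m 4∣a
  ... | no p≢2   | _         =
    uncurry (odd-coprime p p-prime p≢2) (common (ℕD.∣-trans p∣h (subst (h ∣_) (sym g≡h*2) (ℕD.m∣m*n 2))))

bézout-inverse : ∀ a m → gcd a m ≡ 1 → ∃ λ y → + m ∣ℤ + a ℤ.* y ℤ.- + 1
bézout-inverse a m g≡1 with coprime-Bézout (gcd≡1⇒coprime g≡1)
... | Bézout.+- u w 1+wm≡ua = + u , divides (+ w) (begin
  + a ℤ.* + u ℤ.- + 1      ≡⟨ cong (ℤ._- + 1) (trans (sym (ℤP.pos-* a u)) (cong +_ (trans (ℕP.*-comm a u) (sym 1+wm≡ua)))) ⟩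
  + (1 + w * m) ℤ.- + 1    ≡⟨ cancel (+ (w * m)) ⟩
  + (w * m)                ≡⟨ ℤP.pos-* w m ⟩
  + w ℤ.* + m              ∎)
  where
  open ≡-Reasoning
  cancel : ∀ x → (+ 1 ℤ.+ x) ℤ.- + 1 ≡ x
  cancel = solve-∀
... | Bézout.-+ u w 1+ua≡wm = ℤ.- + u , divides (ℤ.- + w) (begin
  + a ℤ.* ℤ.- + u ℤ.- + 1  ≡⟨ negate (+ a) (+ u) ⟩
  ℤ.- (+ 1 ℤ.+ + a ℤ.* + u) ≡⟨ cong (λ x → ℤ.- (+ 1 ℤ.+ x)) (trans (sym (ℤP.pos-* a u)) (cong +_ (ℕP.*-comm a u))) ⟩
  ℤ.- + (1 + u * a)        ≡⟨ cong (λ x → ℤ.- + x) 1+ua≡wm ⟩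
  ℤ.- + (w * m)            ≡⟨ cong ℤ.-_ (ℤP.pos-* w m) ⟩
  ℤ.- (+ w ℤ.* + m)        ≡⟨ ℤP.neg-distribˡ-* (+ w) (+ m) ⟩
  ℤ.- + w ℤ.* + m          ∎)
  where
  open ≡-Reasoning
  negate : ∀ a u → a ℤ.* ℤ.- u ℤ.- + 1 ≡ ℤ.- (+ 1 ℤ.+ a ℤ.* u)
  negate = solve-∀

gcd≡1⇒invertible : ∀ m .{{_ : NonZero m}} x → gcd ∣ x ∣ m ≡ 1 → Invertible m x
gcd≡1⇒invertible m (+ n) g≡1 with bézout-inverse n m g≡1
... | y , m∣ny-1 = y , ∣-⇒%ℕ≡ m (+ n ℤ.* y) (+ 1) m∣ny-1
gcd≡1⇒invertible m ℤ.-[1+ n ] g≡1 with bézout-inverse (suc n) m g≡1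
... | y , m∣ny-1 = ℤ.- y , ∣-⇒%ℕ≡ m (ℤ.-[1+ n ] ℤ.* ℤ.- y) (+ 1)
  (subst (λ z → + m ∣ℤ z ℤ.- + 1) (sym (neg-neg (+ suc n) y)) m∣ny-1)
  where
  neg-neg : ∀ x y → ℤ.- x ℤ.* ℤ.- y ≡ x ℤ.* y
  neg-neg = solve-∀

odd⇒%ℕ2≡1 : ∀ x → ¬ + 2 ∣ℤ x → x %ℕ 2 ≡ 1
odd⇒%ℕ2≡1 x 2∤x with x %ℕ 2 in r≡ | n%ℕd<d x 2
... | zero        | _               = contradiction (subst (+ 2 ∣ℤ_) (ℤP.+-identityʳ x) (%ℕ≡⇒∣- 2 x (+ 0) r≡)) 2∤x
... | suc zero    | _               = refl
... | suc (suc _) | s≤s (s≤s ())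

odd-odd : ∀ {x y} → ¬ + 2 ∣ℤ x → ¬ + 2 ∣ℤ y → + 2 ∣ℤ x ℤ.- y
odd-odd {x} {y} 2∤x 2∤y = %ℕ≡⇒∣- 2 x y (trans (odd⇒%ℕ2≡1 x 2∤x) (sym (odd⇒%ℕ2≡1 y 2∤y)))

even-odd : ∀ {x y} → + 2 ∣ℤ x → ¬ + 2 ∣ℤ y → ¬ + 2 ∣ℤ x ℤ.- y
even-odd {x} {y} 2∣x 2∤y 2∣x-y = 2∤y (subst (+ 2 ∣ℤ_) (sub-sub x y) (∣m∣n⇒∣m-n 2∣x 2∣x-y))
  where
  sub-sub : ∀ x y → x ℤ.- (x ℤ.- y) ≡ y
  sub-sub = solve-∀

odd-even : ∀ {x y} → ¬ + 2 ∣ℤ x → + 2 ∣ℤ y → ¬ + 2 ∣ℤ x ℤ.- y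
odd-even {x} {y} 2∤x 2∣y 2∣x-y = 2∤x (subst (+ 2 ∣ℤ_) (sub-add x y) (∣m∣n⇒∣m+n 2∣x-y 2∣y))
  where
  sub-add : ∀ x y → x ℤ.- y ℤ.+ y ≡ x
  sub-add = solve-∀

-- Edges of the tetrahedron

-- modulo 2 the vertices 0, d₁, d₂, d₃ of a balanced tetrahedron split into two pairs
data EvenVertex (d₁ d₂ d₃ : ℤ) : Set where
  d₁-even : + 2 ∣ℤ d₁ → ¬ + 2 ∣ℤ d₂ → ¬ + 2 ∣ℤ d₃ → EvenVertex d₁ d₂ d₃
  d₂-even : ¬ + 2 ∣ℤ d₁ → + 2 ∣ℤ d₂ → ¬ + 2 ∣ℤ d₃ → EvenVertex d₁ d₂ d₃
  d₃-even : ¬ + 2 ∣ℤ d₁ → ¬ + 2 ∣ℤ d₂ → + 2 ∣ℤ d₃ → EvenVertex d₁ d₂ d₃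

balanced⇒evenVertex : ∀ n d₁ d₂ d₃ → IsBalanced 2 (simplex n (vertices d₁ d₂ d₃)) → EvenVertex d₁ d₂ d₃
balanced⇒evenVertex n d₁ d₂ d₃ bal with + 2 ∣ℤ? d₁ | + 2 ∣ℤ? d₂ | + 2 ∣ℤ? d₃
... | yes e₁ | no o₂  | no o₃  = d₁-even e₁ o₂ o₃
... | no o₁  | yes e₂ | no o₃  = d₂-even o₁ e₂ o₃
... | no o₁  | no o₂  | yes e₃ = d₃-even o₁ o₂ e₃
... | yes e₁ | yes e₂ | yes e₃ = contradiction bal (all-congruent⇒unbalanced 2 (s≤s (s≤s z≤n)) n d₁ (d₂ ∷ d₃ ∷ + 0 ∷ [])
  (∣m∣n⇒∣m-n e₂ e₁ ∷ ∣m∣n⇒∣m-n e₃ e₁ ∷ ∣m∣n⇒∣m-n (∣0 2) e₁ ∷ []))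
... | no o₁  | no o₂  | no o₃  = contradiction bal (three-congruent⇒unbalanced 2 n d₁ d₂ d₃ (+ 0)
  (odd-odd o₂ o₁) (odd-odd o₃ o₁) (even-odd (∣0 2) o₁))
... | no o₁  | yes e₂ | yes e₃ = contradiction (↭-isBalanced 2 n (↭.↭-sym (shift d₁ (d₂ ∷ d₃ ∷ + 0 ∷ []) [])) bal)
  (three-congruent⇒unbalanced 2 n d₂ d₃ (+ 0) d₁ (∣m∣n⇒∣m-n e₃ e₂) (∣m∣n⇒∣m-n (∣0 2) e₂) (odd-even o₁ e₂))
... | yes e₁ | no o₂  | yes e₃ = contradiction (↭-isBalanced 2 n (↭.prep d₁ (↭.↭-sym (shift d₂ (d₃ ∷ + 0 ∷ []) []))) bal)
  (three-congruent⇒unbalanced 2 n d₁ d₃ (+ 0) d₂ (∣m∣n⇒∣m-n e₃ e₁) (∣m∣n⇒∣m-n (∣0 2) e₁) (odd-even o₂ e₁))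
... | yes e₁ | yes e₂ | no o₃  = contradiction (↭-isBalanced 2 n (↭.prep d₁ (↭.prep d₂ (↭.swap d₃ (+ 0) ↭.refl))) bal)
  (three-congruent⇒unbalanced 2 n d₁ d₂ (+ 0) d₃ (∣m∣n⇒∣m-n e₂ e₁) (∣m∣n⇒∣m-n (∣0 2) e₁) (odd-even o₃ e₁))

record EdgeFirst (d₁ d₂ d₃ : ℤ) (δ : Diff) : Set where
  field
    w₀ w₁ w₂ w₃ : ℤ
    reorder     : vertices d₁ d₂ d₃ ↭ w₀ ∷ w₁ ∷ w₂ ∷ w₃ ∷ []
    ∣edge       : ∀ {q} → + q ∣ℤ value d₁ d₂ d₃ δ → + q ∣ℤ w₁ ℤ.- w₀

∣⇒∣0- : ∀ d {q} → + q ∣ℤ d → + q ∣ℤ + 0 ℤ.- d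
∣⇒∣0- d {q} q∣d = subst (+ q ∣ℤ_) (sym (ℤP.+-identityˡ (ℤ.- d))) (∣m⇒∣-m q∣d)

edgeFirst : ∀ d₁ d₂ d₃ δ → EdgeFirst d₁ d₂ d₃ δ
edgeFirst d₁ d₂ d₃ δ₁ = record
  { w₀ = d₁ ; w₁ = + 0 ; w₂ = d₂ ; w₃ = d₃
  ; reorder = ↭.prep d₁ (shift (+ 0) (d₂ ∷ d₃ ∷ []) [])
  ; ∣edge = ∣⇒∣0- d₁ }
edgeFirst d₁ d₂ d₃ δ₂ = record
  { w₀ = d₂ ; w₁ = + 0 ; w₂ = d₁ ; w₃ = d₃
  ; reorder = ↭.trans (↭.swap d₁ d₂ ↭.refl) (↭.prep d₂ (shift (+ 0) (d₁ ∷ d₃ ∷ []) []))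
  ; ∣edge = ∣⇒∣0- d₂ }
edgeFirst d₁ d₂ d₃ δ₃ = record
  { w₀ = d₃ ; w₁ = + 0 ; w₂ = d₁ ; w₃ = d₂
  ; reorder = ↭.trans (shift d₃ (d₁ ∷ d₂ ∷ []) (+ 0 ∷ [])) (↭.prep d₃ (shift (+ 0) (d₁ ∷ d₂ ∷ []) []))
  ; ∣edge = ∣⇒∣0- d₃ }
edgeFirst d₁ d₂ d₃ δ₂₁ = record
  { w₀ = d₁ ; w₁ = d₂ ; w₂ = d₃ ; w₃ = + 0 ; reorder = ↭.refl ; ∣edge = λ q∣ → q∣ }
edgeFirst d₁ d₂ d₃ δ₃₂ = record
  { w₀ = d₂ ; w₁ = d₃ ; w₂ = d₁ ; w₃ = + 0 ; reorder = ↭.↭-sym (shift d₁ (d₂ ∷ d₃ ∷ []) (+ 0 ∷ [])) ; ∣edge = λ q∣ → q∣ }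
edgeFirst d₁ d₂ d₃ δ₁₃ = record
  { w₀ = d₃ ; w₁ = d₁ ; w₂ = d₂ ; w₃ = + 0 ; reorder = shift d₃ (d₁ ∷ d₂ ∷ []) (+ 0 ∷ []) ; ∣edge = λ q∣ → q∣ }

pair-congruent⇒unbalanced : ∀ p → Prime p → 3 ≤ p → ∀ n w₀ w₁ w₂ w₃ → + p ∣ℤ w₁ ℤ.- w₀ →
  ¬ IsBalanced p (simplex n (w₀ ∷ w₁ ∷ w₂ ∷ w₃ ∷ []))
pair-congruent⇒unbalanced p p-prime 3≤p n w₀ w₁ w₂ w₃ w₁≡w₀ bal with + p ∣ℤ? w₂ ℤ.- w₀ | + p ∣ℤ? w₃ ℤ.- w₀
... | yes w₂≡w₀ | yes w₃≡w₀ =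
  all-congruent⇒unbalanced p (ℕP.<-trans (s≤s (s≤s z≤n)) 3≤p) n w₀ (w₁ ∷ w₂ ∷ w₃ ∷ []) (w₁≡w₀ ∷ w₂≡w₀ ∷ w₃≡w₀ ∷ []) bal
... | yes w₂≡w₀ | no  w₃≢w₀ = three-congruent⇒unbalanced p n w₀ w₁ w₂ w₃ w₁≡w₀ w₂≡w₀ w₃≢w₀ bal
... | no  w₂≢w₀ | yes w₃≡w₀ = three-congruent⇒unbalanced p n w₀ w₁ w₃ w₂ w₁≡w₀ w₃≡w₀ w₂≢w₀
  (↭-isBalanced p n (↭.prep w₀ (↭.prep w₁ (↭.swap w₂ w₃ ↭.refl))) bal)
... | no  w₂≢w₀ | no  w₃≢w₀ = two-congruent⇒unbalanced p 3≤p n w₀ w₁ w₂ w₃ w₁≡w₀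
  (prime-cancels p p-prime _ w₂≢w₀) (prime-cancels p p-prime _ w₃≢w₀) bal

odd-prime∤edge : ∀ p → Prime p → 3 ≤ p → ∀ n d₁ d₂ d₃ → IsBalanced p (simplex n (vertices d₁ d₂ d₃)) →
  ∀ δ → ¬ + p ∣ℤ value d₁ d₂ d₃ δ
odd-prime∤edge p p-prime 3≤p n d₁ d₂ d₃ bal δ p∣δ =
  pair-congruent⇒unbalanced p p-prime 3≤p n w₀ w₁ w₂ w₃ (∣edge p∣δ) (↭-isBalanced p n reorder bal)
  where open EdgeFirst (edgeFirst d₁ d₂ d₃ δ)

four∤edge : ∀ n d₁ d₂ d₃ → IsBalanced 4 (simplex n (vertices d₁ d₂ d₃)) → ∀ δ →
  let open EdgeFirst (edgeFirst d₁ d₂ d₃ δ) in ¬ + 2 ∣ℤ w₂ ℤ.- w₀ → ¬ + 2 ∣ℤ w₃ ℤ.- w₀ → ¬ + 4 ∣ℤ value d₁ d₂ d₃ δ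
four∤edge n d₁ d₂ d₃ bal δ 2∤w₂-w₀ 2∤w₃-w₀ 4∣δ =
  two-congruent⇒unbalanced 4 (s≤s (s≤s (s≤s z≤n))) n w₀ w₁ w₂ w₃ (∣edge 4∣δ)
    (odd-cancels-4 _ 2∤w₂-w₀) (odd-cancels-4 _ 2∤w₃-w₀) (↭-isBalanced 4 n reorder bal)
  where open EdgeFirst (edgeFirst d₁ d₂ d₃ δ)

module _ (m n : ℕ) .{{_ : NonZero m}} (a d₁ d₂ d₃ : ℤ) (bal : Balanced m a d₁ d₂ d₃ (suc n)) where

  private
    v : Diff → ℤ
    v = value d₁ d₂ d₃

    OppositeEvenEdges : Set
    OppositeEvenEdges = ∃₂ λ (δ δ' : Diff) → NonAdjacent δ δ'
      × gcdℤ (v δ) m ≡ 2 × gcdℤ (v δ') m ≡ 2 × (∀ (ε : Diff) → ε ≢ δ → ε ≢ δ' → Invertible m (v ε))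

    isBalanced : ∀ q → q ∣ m → IsBalanced q (simplex n (vertices d₁ d₂ d₃))
    isBalanced = balanced⇒isBalanced m n a d₁ d₂ d₃ bal

    odd-prime∤ : ∀ p → Prime p → p ≢ 2 → p ∣ m → ∀ δ → ¬ p ∣ ∣ v δ ∣
    odd-prime∤ p p-prime p≢2 p∣m δ p∣δ =
      odd-prime∤edge p p-prime (odd-prime≥3 p p-prime p≢2) n d₁ d₂ d₃ (isBalanced p p∣m) δ (∣ᵤ⇒∣ p∣δ)

  edge-invertible : ∀ δ → (2 ∣ m → ¬ + 2 ∣ℤ v δ) → Invertible m (v δ)
  edge-invertible δ 2∤δ = gcd≡1⇒invertible m (v δ) (gcd≡1 ∣ v δ ∣ m coprime)
    where
    coprime : ∀ p → Prime p → p ∣ m → ¬ p ∣ ∣ v δ ∣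
    coprime p p-prime p∣m with p ℕ.≟ 2
    ... | yes refl = 2∤δ p∣m ∘ ∣ᵤ⇒∣
    ... | no  p≢2  = odd-prime∤ p p-prime p≢2 p∣m δ

  even-edge-gcd : 2 ∣ m → ∀ δ → + 2 ∣ℤ v δ → (4 ∣ m → ¬ + 4 ∣ℤ v δ) → gcdℤ (v δ) m ≡ 2
  even-edge-gcd 2∣m δ 2∣δ 4∤δ = gcd≡2 ∣ v δ ∣ m (∣⇒∣ᵤ 2∣δ) 2∣m (λ 4∣m → 4∤δ 4∣m ∘ ∣ᵤ⇒∣)
    (λ p p-prime p≢2 p∣m → odd-prime∤ p p-prime p≢2 p∣m δ)

  odd-modulus : ¬ 2 ∣ m → ∀ δ → Invertible m (v δ)
  odd-modulus 2∤m δ = edge-invertible δ (λ 2∣m → contradiction 2∣m 2∤m)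

  even-edges : 2 ∣ m → EvenVertex d₁ d₂ d₃ → OppositeEvenEdges
  even-edges 2∣m (d₁-even e₁ o₂ o₃) = δ₁ , δ₃₂ , na₁
    , even-edge-gcd 2∣m δ₁ e₁
        (λ 4∣m → four∤edge n d₁ d₂ d₃ (isBalanced 4 4∣m) δ₁ (odd-even o₂ e₁) (odd-even o₃ e₁))
    , even-edge-gcd 2∣m δ₃₂ (odd-odd o₃ o₂)
        (λ 4∣m → four∤edge n d₁ d₂ d₃ (isBalanced 4 4∣m) δ₃₂ (even-odd e₁ o₂) (even-odd (∣0 2) o₂))
    , λ ε ε≢ ε≢′ → edge-invertible ε (λ _ → odd ε ε≢ ε≢′)
    where
    odd : ∀ ε → ε ≢ δ₁ → ε ≢ δ₃₂ → ¬ + 2 ∣ℤ v ε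
    odd δ₁  ≢δ₁ _    = contradiction refl ≢δ₁
    odd δ₃₂ _   ≢δ₃₂ = contradiction refl ≢δ₃₂
    odd δ₂  _   _    = o₂
    odd δ₃  _   _    = o₃
    odd δ₂₁ _   _    = odd-even o₂ e₁
    odd δ₁₃ _   _    = even-odd e₁ o₃
  even-edges 2∣m (d₂-even o₁ e₂ o₃) = δ₂ , δ₁₃ , na₂
    , even-edge-gcd 2∣m δ₂ e₂
        (λ 4∣m → four∤edge n d₁ d₂ d₃ (isBalanced 4 4∣m) δ₂ (odd-even o₁ e₂) (odd-even o₃ e₂))
    , even-edge-gcd 2∣m δ₁₃ (odd-odd o₁ o₃)
        (λ 4∣m → four∤edge n d₁ d₂ d₃ (isBalanced 4 4∣m) δ₁₃ (even-odd e₂ o₃) (even-odd (∣0 2) o₃))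
    , λ ε ε≢ ε≢′ → edge-invertible ε (λ _ → odd ε ε≢ ε≢′)
    where
    odd : ∀ ε → ε ≢ δ₂ → ε ≢ δ₁₃ → ¬ + 2 ∣ℤ v ε
    odd δ₂  ≢δ₂ _    = contradiction refl ≢δ₂
    odd δ₁₃ _   ≢δ₁₃ = contradiction refl ≢δ₁₃
    odd δ₁  _   _    = o₁
    odd δ₃  _   _    = o₃
    odd δ₂₁ _   _    = even-odd e₂ o₁
    odd δ₃₂ _   _    = odd-even o₃ e₂
  even-edges 2∣m (d₃-even o₁ o₂ e₃) = δ₃ , δ₂₁ , na₃
    , even-edge-gcd 2∣m δ₃ e₃
        (λ 4∣m → four∤edge n d₁ d₂ d₃ (isBalanced 4 4∣m) δ₃ (odd-even o₁ e₃) (odd-even o₂ e₃))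
    , even-edge-gcd 2∣m δ₂₁ (odd-odd o₂ o₁)
        (λ 4∣m → four∤edge n d₁ d₂ d₃ (isBalanced 4 4∣m) δ₂₁ (even-odd e₃ o₁) (even-odd (∣0 2) o₁))
    , λ ε ε≢ ε≢′ → edge-invertible ε (λ _ → odd ε ε≢ ε≢′)
    where
    odd : ∀ ε → ε ≢ δ₃ → ε ≢ δ₂₁ → ¬ + 2 ∣ℤ v ε
    odd δ₃  ≢δ₃ _    = contradiction refl ≢δ₃
    odd δ₂₁ _   ≢δ₂₁ = contradiction refl ≢δ₂₁
    odd δ₁  _   _    = o₁
    odd δ₂  _   _    = o₂
    odd δ₃₂ _   _    = even-odd e₃ o₂
    odd δ₁₃ _   _    = odd-even o₁ e₃

  even-modulus : 2 ∣ m → OppositeEvenEdges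
  even-modulus 2∣m = even-edges 2∣m (balanced⇒evenVertex n d₁ d₂ d₃ (isBalanced 2 2∣m))

theorem3p8 : (m s : ℕ) .{{_ : NonZero m}} → .{{_ : NonZero s}} → (a d₁ d₂ d₃ : ℤ) →
  Balanced m a d₁ d₂ d₃ s →
  ((¬ (2 ∣ m)) → ∀ (δ : Diff) → Invertible m (value d₁ d₂ d₃ δ)) ×
  ((2 ∣ m) → ∃₂ λ (δ δ' : Diff) → NonAdjacent δ δ'
    × gcdℤ (value d₁ d₂ d₃ δ) m ≡ 2 × gcdℤ (value d₁ d₂ d₃ δ') m ≡ 2
    × (∀ (ε : Diff) → ε ≢ δ → ε ≢ δ' → Invertible m (value d₁ d₂ d₃ ε)))
-- s = 0 is ruled out by the instance NonZero s, so only suc n needs a clause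
theorem3p8 m (suc n) a d₁ d₂ d₃ bal = odd-modulus m n a d₁ d₂ d₃ bal , even-modulus m n a d₁ d₂ d₃ bal
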